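{- Let $\bar{\mathbf x},\bar{\mathbf y}\in\mathbb{P}(\mathbb{Z})$ be distinct. (a) Every shortest path in $G$ between $\bar{\mathbf x}$ and $\bar{\mathbf y}$ has all its vertices in the Klein graph $K(\bar{\mathbf x},\bar{\mathbf y})$. (b) Among all shortest paths between $\bar{\mathbf x}$ and $\bar{\mathbf y}$, at least one has all its vertices in the corner graph $\tilde K(\bar{\mathbf x},\bar{\mathbf y})$.
   Context: **Projective line and distant graph.** The points of $\mathbb{P}(\mathbb{Z})$ are the submodules $\bar{\mathbf v}=\mathbb{Z}\mathbf v\subset\mathbb{Z}^2$ with $\mathbf v=(a,b)$, $\gcd(a,b)=1$. A generator is a representative and is unique up to sign. Points are adjacent if $\det[\mathbf x,\mathbf y]=\pm1$. The distant graph $G$ has vertex set $\mathbb{P}(\mathbb{Z})$ and edges the adjacent pairs. A path is a sequence of distinct vertices with consecutive ones adjacent. **Adjacent case.** If $\bar{\mathbf x},\bar{\mathbf y}$ are adjacent, $K(\bar{\mathbf x},\bar{\mathbf y})$ and $\tilde K(\bar{\mathbf x},\bar{\mathbf y})$ are both the subgraph induced on $\{\bar{\mathbf x},\bar{\mathbf y}\}$. **Transition algorithm** (non-adjacent case, with fixed representatives $\mathbf x,\mathbf y$). - Put $P=\{\alpha\mathbf x+\beta\mathbf y:\alpha>0,\beta>0\}$ and $N=\{\alpha\mathbf x+\beta\mathbf y:\alpha<0,\beta>0\}$. - The integer vectors $\mathbf c$ with $|\det[\mathbf x,\mathbf c]|=1$ and $\beta>0$ form a sequence $\mathbf c_n=\mathbf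 c_0-n\mathbf x$. There is a unique $n$ with $\mathbf u:=\mathbf c_n\in P$ and $\mathbf w:=\mathbf c_{n+1}\in N$. - If $\mathbf u+\mathbf w=\mathbf y$, put $\mathbf e_1=\mathbf u$, $\mathbf f_1=\mathbf w$, $r=l=0$, and stop. - Otherwise let $Q_e$ be the one of $P,N$ containing $\mathbf u+\mathbf w$ and $Q_f$ the other. Let $\mathbf e_1$ be the one of $\mathbf u,\mathbf w$ in $Q_e$ and $\mathbf f_1$ the other. - Starting from the lists $(\mathbf e_1)$ and $(\mathbf f_1)$, repeat the following. Let $\mathbf s$ be the sum of the last entries. If $\mathbf s=\mathbf y$, stop. If $\mathbf s\in Q_e$, append it to the e-list (E-step). Otherwise append it to the f-list (F-step). - This terminates. The word of steps is $E^{a_1}F^{b_1}E^{a_2}F^{b_2}\cdots$ with exponents $\ge1$, having $r$ E-blocks and $l$ F-blocks. - Put $a_0=b_0=1$, $A_k=\sum_{n=0}^k a_n$ and $B_k=\sum_{n=0}^k b_n$. The lists are $(\mathbf e_1,\dots,\mathbf e_{A_r})$ and $(\mathbf f_1,\dots,\mathbf f_{B_l})$. Bars denote the corresponding points. **Klein graph and corner graph.** - The Klein graph $K(\bar{\mathbf x},\bar{\mathbf y})$ is the subgraph of $G$ induced on $\{\bar{\mathbf x},\bar{\mathbf y}\}\cup\{\bar{\mathbf e}_1,\dots,\bar{\mathbf e}_{A_r}\}\cup\{\bar{\mathbf f}_1,\dots,\bar{\mathbf f}_{B_l}\}$. - The corner vertices are $\bar{\mathbf e}_{A_k}$ ($0\le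 k\le r$) and $\bar{\mathbf f}_{B_k}$ ($0\le k\le l$). - The corner graph $\tilde K(\bar{\mathbf x},\bar{\mathbf y})$ is the subgraph of $G$ induced on $\{\bar{\mathbf x},\bar{\mathbf y}\}$ together with the corner vertices. -}

module Defs where

open import Data.Nat as ℕ using (ℕ; suc)
open import Data.Integer using (ℤ; +_; -_; _*_; _+_; _-_; ∣_∣)
open import Data.Nat.GCD using (gcd)
open import Data.Product using (_×_; _,_; Σ; ∃; ∃-syntax)
open import Data.Sum using (_⊎_)
open import Data.Bool using (Bool; true; false)
open import Data.List using (List; []; _∷_; length)
open import Data.List.Relation.Unary.All using (All)
open import Data.List.Relation.Unary.Linked using (Linked)
open import Data.List.Relation.Unary.AllPairs using (AllPairs)
open import Relation.Binary.PropositionalEquality using (_≡_)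
open import Relation.Nullary using (¬_)
open import Data.Empty using (⊥)
open import Data.Unit using (⊤)

V : Set
V = ℤ × ℤ

infixl 6 _⊕_ _⊖_
infixl 7 _·_

_⊕_ : V → V → V
(a , b) ⊕ (c , d) = (a + c , b + d)

_⊖_ : V → V → V
(a , b) ⊖ (c , d) = (a - c , b - d)

_·_ : ℤ → V → V
k · (a , b) = (k * a , k * b)

neg : V → V
neg (a , b) = (- a , - b)

det : V → V → ℤ
det (a , b) (c , d) = a * d - b * c

-- (a , b) is a generator of a point of P(ℤ): gcd(a,b) = 1
Primitive : V → Set
Primitive (a , b) = gcd ∣ a ∣ ∣ b ∣ ≡ 1

-- two generators represent the same point of P(ℤ) (generators unique up to sign)
_~_ : V → V → Set
v ~ w = (v ≡ w) ⊎ (v ≡ neg w)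

Adj : V → V → Set
Adj v w = ∣ det v w ∣ ≡ 1

-- Paths in the distant graph G, represented by lists of generators.
-- Vertices are points of P(ℤ), consecutive ones adjacent, all distinct
-- (as points, i.e. up to sign).

IsPath : List V → Set
IsPath p = All Primitive p × Linked Adj p × AllPairs (λ v w → ¬ (v ~ w)) p

HeadIs : V → List V → Set
HeadIs x []      = ⊥
HeadIs x (v ∷ _) = v ~ x

LastIs : V → List V → Set
LastIs x []           = ⊥
LastIs x (v ∷ [])     = v ~ x
LastIs x (_ ∷ w ∷ p)  = LastIs x (w ∷ p)

PathBetween : V → V → List V → Set
PathBetween x y p = IsPath p × HeadIs x p × LastIs y p

-- shortest path between x and y (length compared via number of vertices)
Shortest : V → V → List V → Set
Shortest x y p = PathBetween x y p × (∀ q → PathBetween x y q → length p ℕ.≤ length q)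

-- s ∈ P = {αx + βy : α > 0, β > 0}.  As s is integral and x,y independent,
-- α, β are rational; we write α = a/m, β = b/m with a, b, m positive naturals.
InP : V → V → V → Set
InP x y s = ∃[ m ] ∃[ a ] ∃[ b ] ((+ suc m) · s ≡ (+ suc a) · x ⊕ (+ suc b) · y)

InN : V → V → V → Set
InN x y s = ∃[ m ] ∃[ a ] ∃[ b ] ((+ suc m) · s ≡ (- (+ suc a)) · x ⊕ (+ suc b) · y)

InQ : Bool → V → V → V → Set
InQ true  x y s = InP x y s
InQ false x y s = InN x y s

-- u = c_n with |det[x,c_n]| = 1, c_n ∈ P, w = c_{n+1} = c_n - x ∈ N.
IsU : V → V → V → Set
IsU x y u = Adj x u × InP x y u × InN x y (u ⊖ x)

-- Initialisation: Setup x y q e₁ f₁ says that the algorithm starts with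
-- cone Q_e given by q and first entries e₁, f₁.
data Setup (x y : V) : Bool → V → V → Set where
  -- u + w = y : e₁ = u, f₁ = w (loop stops at once; the cone is irrelevant)
  stop  : ∀ u → IsU x y u → u ⊕ (u ⊖ x) ≡ y → Setup x y true u (u ⊖ x)
  viaP  : ∀ u → IsU x y u → ¬ (u ⊕ (u ⊖ x) ≡ y) → InP x y (u ⊕ (u ⊖ x)) →
          Setup x y true u (u ⊖ x)
  viaN  : ∀ u → IsU x y u → ¬ (u ⊕ (u ⊖ x) ≡ y) → InN x y (u ⊕ (u ⊖ x)) →
          Setup x y false (u ⊖ x) u

data Kind : Set where
  start stepE stepF : Kind

-- Reach x y q e₁ f₁ k t e f : after k steps the last entries of the
-- e-list and f-list are e and f, and the k-th step was of kind t.
data Reach (x y : V) (q : Bool) (e₁ f₁ : V) : ℕ → Kind → V → V → Set where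
  init : Reach x y q e₁ f₁ 0 start e₁ f₁
  eStep : ∀ {k t e f} → Reach x y q e₁ f₁ k t e f → ¬ (e ⊕ f ≡ y) →
          InQ q x y (e ⊕ f) → Reach x y q e₁ f₁ (suc k) stepE (e ⊕ f) f
  fStep : ∀ {k t e f} → Reach x y q e₁ f₁ k t e f → ¬ (e ⊕ f ≡ y) →
          ¬ InQ q x y (e ⊕ f) → Reach x y q e₁ f₁ (suc k) stepF e (e ⊕ f)

NextNotE : Bool → V → V → V → V → Set
NextNotE q x y e f = (e ⊕ f ≡ y) ⊎ ¬ InQ q x y (e ⊕ f)

NextNotF : Bool → V → V → V → V → Set
NextNotF q x y e f = (e ⊕ f ≡ y) ⊎ InQ q x y (e ⊕ f)

-- e-entry of a state is a corner e_{A_k}: it is e₁, or it ends an E-block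
ECorner : Kind → Bool → V → V → V → V → Set
ECorner start q x y e f = ⊤
ECorner stepE q x y e f = NextNotE q x y e f
ECorner stepF q x y e f = ⊥

-- f-entry of a state is a corner f_{B_k}: it is f₁, or it ends an F-block
FCorner : Kind → Bool → V → V → V → V → Set
FCorner start q x y e f = ⊤
FCorner stepE q x y e f = ⊥
FCorner stepF q x y e f = NextNotF q x y e f

-- Vertex sets of the Klein graph K(x̄,ȳ) and the corner graph K̃(x̄,ȳ).
-- (Both are induced subgraphs of G, so they are determined by their
-- vertex sets; in the adjacent case both vertex sets are {x̄ , ȳ}.)

KleinV : V → V → V → Set
KleinV x y v =
  (v ~ x) ⊎ (v ~ y) ⊎
  (¬ Adj x y × ∃[ q ] ∃[ e₁ ] ∃[ f₁ ] (Setup x y q e₁ f₁ ×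
     ∃[ k ] ∃[ t ] ∃[ e ] ∃[ f ] (Reach x y q e₁ f₁ k t e f × ((v ~ e) ⊎ (v ~ f)))))

CornerV : V → V → V → Set
CornerV x y v =
  (v ~ x) ⊎ (v ~ y) ⊎
  (¬ Adj x y × ∃[ q ] ∃[ e₁ ] ∃[ f₁ ] (Setup x y q e₁ f₁ ×
     ∃[ k ] ∃[ t ] ∃[ e ] ∃[ f ] (Reach x y q e₁ f₁ k t e f ×
       ((ECorner t q x y e f × v ~ e) ⊎ (FCorner t q x y e f × v ~ f)))))

-- For a unimodular pair (e , f) let side z = det(e,z) det(f,z). By the Plücker identity
-- det(e,f) det(z,w) = det(e,z) det(f,w) - det(e,w) det(f,z), adjacent vertices never lie on strictly
-- opposite sides, and a vertex of side 0 adjacent to another one is ±e or ±f. As x and e + f lie on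
-- opposite sides, every walk from x to e + f passes through ±e or ±f, whence
-- d(x, e + f) ≥ 1 + min (d(x,e), d(x,f)), and a walk attaining this bound stays in the Klein graph
-- once the shorter walks to e and f do. The transition algorithm only ever adds the two current last
-- entries, which remain unimodular with y = (p+1) e + (q+1) f and p + q decreasing, so the bound
-- reaches y. It is attained by a path through corners: extend the shorter of the paths to e and f
-- by e + f. The coefficient of y grows strictly along such a path, so its vertices are distinct.

module Submission where

open import Defs
open import Data.Bool using (Bool; true; false)
open import Data.Empty using (⊥; ⊥-elim)
open import Data.Unit using (tt)
open import Data.Product using (_×_; ∃-syntax; Σ; _,_; proj₁; proj₂)
open import Data.Sum using (_⊎_; inj₁; inj₂)
open import Data.List using (List; []; _∷_; length; _++_; _∷ʳ_)
open import Data.List.Properties using (length-++)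
open import Data.List.Relation.Unary.All using (All; []; _∷_)
import Data.List.Relation.Unary.All as All
open import Data.List.Relation.Unary.All.Properties using (++⁺; ∷ʳ⁺)
open import Data.List.Relation.Unary.Linked using (Linked; []; [-]; _∷_)
open import Data.List.Relation.Unary.Linked.Properties using (Linked⇒AllPairs)
open import Data.List.Relation.Unary.AllPairs using (AllPairs; []; _∷_)
open import Data.Nat as ℕ using (ℕ; zero; suc; z≤n; s≤s; _⊓_)
import Data.Nat.Properties as ℕP
import Data.Nat.Divisibility as ℕ
open import Data.Nat.GCD using (gcd; GCD; gcd-GCD; gcd-greatest; gcd[m,n]∣m; gcd[m,n]∣n; module Bézout)
open import Data.Integer
  using (ℤ; +_; -[1+_]; -_; _*_; _+_; _-_; ∣_∣; _<_; _≤_; +<+; -<+; +≤+; 0ℤ; 1ℤ; -1ℤ)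
import Data.Integer.Properties as ℤP
open import Data.Integer.Divisibility.Signed as ℤ using (∣ᵤ⇒∣; ∣⇒∣ᵤ; ∣m⇒∣m*n; ∣m∣n⇒∣m-n)
open import Data.Integer.DivMod using (_%ℕ_; _/ℕ_; a≡a%ℕn+[a/ℕn]*n; n%ℕd<d)
open import Data.Integer.Tactic.RingSolver using (solve-∀)
open import Relation.Nullary using (¬_; yes; no)
open import Relation.Binary.Definitions using (tri<; tri≈; tri>)
open import Relation.Binary.PropositionalEquality
  using (_≡_; refl; sym; trans; cong; cong₂; subst; subst₂; module ≡-Reasoning)

0<⇒≡+[1+] : ∀ {a} → 0ℤ < a → ∃[ m ] a ≡ + suc m
0<⇒≡+[1+] {+ suc m} _ = m , refl
0<⇒≡+[1+] {+ 0} (+<+ ())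

<0⇒≡-[1+] : ∀ {a} → a < 0ℤ → ∃[ m ] a ≡ -[1+ m ]
<0⇒≡-[1+] { -[1+ m ]} _ = m , refl
<0⇒≡-[1+] {+ _} (+<+ ())

*-pos : ∀ {a b} → 0ℤ < a → 0ℤ < b → 0ℤ < a * b
*-pos {+ suc m} {+ suc n} _ _ = +<+ (s≤s z≤n)
*-pos {+ 0} (+<+ ())
*-pos {+ suc m} {+ 0} _ (+<+ ())

*-neg : ∀ {a b} → a < 0ℤ → b < 0ℤ → 0ℤ < a * b
*-neg { -[1+ m ]} { -[1+ n ]} _ _ = +<+ (s≤s z≤n)
*-neg {+ _} (+<+ ())
*-neg { -[1+ m ]} {+ _} _ (+<+ ())

*-pos-neg : ∀ {a b} → 0ℤ < a → b < 0ℤ → a * b < 0ℤ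
*-pos-neg {+ suc m} { -[1+ n ]} _ _ = -<+
*-pos-neg {+ 0} (+<+ ())
*-pos-neg {+ suc m} {+ _} _ (+<+ ())

*-neg-pos : ∀ {a b} → a < 0ℤ → 0ℤ < b → a * b < 0ℤ
*-neg-pos { -[1+ m ]} {+ suc n} _ _ = -<+
*-neg-pos {+ _} (+<+ ())
*-neg-pos { -[1+ m ]} {+ 0} _ (+<+ ())

+-pos : ∀ {a b} → 0ℤ < a → 0ℤ < b → 0ℤ < a + b
+-pos {+ suc m} {+ suc n} _ _ = +<+ (s≤s z≤n)
+-pos {+ 0} (+<+ ())
+-pos {+ suc m} {+ 0} _ (+<+ ())

+-neg : ∀ {a b} → a < 0ℤ → b < 0ℤ → a + b < 0ℤ
+-neg { -[1+ m ]} { -[1+ n ]} _ _ = -<+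
+-neg { -[1+ m ]} {+ n} _ (+<+ ())
+-neg {+ n} (+<+ ())

0≮a*0 : ∀ a → ¬ (0ℤ < a * 0ℤ)
0≮a*0 a = ℤP.<-irrefl (sym (ℤP.*-zeroʳ a))

a*0≮0 : ∀ a → ¬ (a * 0ℤ < 0ℤ)
a*0≮0 a = ℤP.<-irrefl (ℤP.*-zeroʳ a)

0<*⇒sameSign : ∀ {a b} → 0ℤ < a * b → (0ℤ < a × 0ℤ < b) ⊎ (a < 0ℤ × b < 0ℤ)
0<*⇒sameSign {+ suc m} {+ suc n} _ = inj₁ (+<+ (s≤s z≤n) , +<+ (s≤s z≤n))
0<*⇒sameSign { -[1+ m ]} { -[1+ n ]} _ = inj₂ (-<+ , -<+)
0<*⇒sameSign {+ 0} (+<+ ())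
0<*⇒sameSign {a@(+ suc _)} {+ 0} p = ⊥-elim (0≮a*0 a p)
0<*⇒sameSign {a@(-[1+ _ ])} {+ 0} p = ⊥-elim (0≮a*0 a p)
0<*⇒sameSign {+ suc m} { -[1+ n ]} ()
0<*⇒sameSign { -[1+ m ]} {+ suc n} ()

*<0⇒oppositeSign : ∀ {a b} → a * b < 0ℤ → (0ℤ < a × b < 0ℤ) ⊎ (a < 0ℤ × 0ℤ < b)
*<0⇒oppositeSign {+ suc m} { -[1+ n ]} _ = inj₁ (+<+ (s≤s z≤n) , -<+)
*<0⇒oppositeSign { -[1+ m ]} {+ suc n} _ = inj₂ (-<+ , +<+ (s≤s z≤n))
*<0⇒oppositeSign {+ 0} (+<+ ())
*<0⇒oppositeSign {a@(+ suc _)} {+ 0} p = ⊥-elim (a*0≮0 a p)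
*<0⇒oppositeSign {a@(-[1+ _ ])} {+ 0} p = ⊥-elim (a*0≮0 a p)
*<0⇒oppositeSign {+ suc m} {+ suc n} (+<+ ())
*<0⇒oppositeSign { -[1+ m ]} { -[1+ n ]} (+<+ ())

0<*⇒0<[a+b]*b : ∀ {a b} → 0ℤ < a * b → 0ℤ < (a + b) * b
0<*⇒0<[a+b]*b {a} {b} p with 0<*⇒sameSign {a} {b} p
... | inj₁ (0<a , 0<b) = *-pos (+-pos 0<a 0<b) 0<b
... | inj₂ (a<0 , b<0) = *-neg (+-neg a<0 b<0) b<0

0<*⇒0<a*[a+b] : ∀ {a b} → 0ℤ < a * b → 0ℤ < a * (a + b)
0<*⇒0<a*[a+b] {a} {b} p with 0<*⇒sameSign {a} {b} p
... | inj₁ (0<a , 0<b) = *-pos 0<a (+-pos 0<a 0<b)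
... | inj₂ (a<0 , b<0) = *-neg a<0 (+-neg a<0 b<0)

0<[1+m]*a⇒0<a : ∀ {a m} → 0ℤ < + suc m * a → 0ℤ < a
0<[1+m]*a⇒0<a {a} {m} p with 0<*⇒sameSign {+ suc m} {a} p
... | inj₁ (_ , 0<a) = 0<a
... | inj₂ (+<+ () , _)

[1+m]*a<0⇒a<0 : ∀ {a m} → + suc m * a < 0ℤ → a < 0ℤ
[1+m]*a<0⇒a<0 {a} {m} p with *<0⇒oppositeSign {+ suc m} {a} p
... | inj₁ (_ , a<0) = a<0
... | inj₂ (+<+ () , _)

a≢0⇒0<a*a : ∀ {a} → ¬ (a ≡ 0ℤ) → 0ℤ < a * a
a≢0⇒0<a*a {+ suc m} _ = *-pos {+ suc m} (+<+ (s≤s z≤n)) (+<+ (s≤s z≤n))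
a≢0⇒0<a*a { -[1+ m ]} _ = *-neg { -[1+ m ]} -<+ -<+
a≢0⇒0<a*a {+ 0} a≢0 = ⊥-elim (a≢0 refl)

∣a∣≡1⇒a≡±1 : ∀ {a} → ∣ a ∣ ≡ 1 → a ≡ 1ℤ ⊎ a ≡ -1ℤ
∣a∣≡1⇒a≡±1 {+ .1} refl = inj₁ refl
∣a∣≡1⇒a≡±1 { -[1+ 0 ]} _ = inj₂ refl
∣a∣≡1⇒a≡±1 { -[1+ suc n ]} ()

∣a∣≡1⇒a*a≡1 : ∀ {a} → ∣ a ∣ ≡ 1 → a * a ≡ 1ℤ
∣a∣≡1⇒a*a≡1 {a} ∣a∣≡1 with ∣a∣≡1⇒a≡±1 {a} ∣a∣≡1
... | inj₁ refl = refl
... | inj₂ refl = refl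

∣a∣≡1⇒a*-a<0 : ∀ {a} → ∣ a ∣ ≡ 1 → a * (- a) < 0ℤ
∣a∣≡1⇒a*-a<0 {a} ∣a∣≡1 with ∣a∣≡1⇒a≡±1 {a} ∣a∣≡1
... | inj₁ refl = -<+
... | inj₂ refl = -<+

∣a∣≡1⇒a≢[2+m]*a : ∀ {a m} → ∣ a ∣ ≡ 1 → ¬ (a ≡ + suc (suc m) * a)
∣a∣≡1⇒a≢[2+m]*a {a} {m} ∣a∣≡1 a≡ with begin
    2 ℕ.+ m                    ≡⟨ ℕP.*-identityʳ (2 ℕ.+ m) ⟨
    (2 ℕ.+ m) ℕ.* 1            ≡⟨ cong ((2 ℕ.+ m) ℕ.*_) ∣a∣≡1 ⟨
    (2 ℕ.+ m) ℕ.* ∣ a ∣        ≡⟨ ℤP.abs-* (+ suc (suc m)) a ⟨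
    ∣ + suc (suc m) * a ∣      ≡⟨ cong ∣_∣ a≡ ⟨
    ∣ a ∣                      ≡⟨ ∣a∣≡1 ⟩
    1                          ∎
  where open ≡-Reasoning
... | ()

a*b<0⇒2≤∣a-b∣ : ∀ {a b} → a * b < 0ℤ → 2 ℕ.≤ ∣ a - b ∣
a*b<0⇒2≤∣a-b∣ {+ suc m} { -[1+ n ]} _ = s≤s (ℕP.≤-trans (s≤s z≤n) (ℕP.m≤n+m (suc n) m))
a*b<0⇒2≤∣a-b∣ { -[1+ m ]} {+ suc n} _ = s≤s (s≤s z≤n)
a*b<0⇒2≤∣a-b∣ {+ 0} (+<+ ())
a*b<0⇒2≤∣a-b∣ {a@(+ suc _)} {+ 0} p = ⊥-elim (a*0≮0 a p)
a*b<0⇒2≤∣a-b∣ {a@(-[1+ _ ])} {+ 0} p = ⊥-elim (a*0≮0 a p)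
a*b<0⇒2≤∣a-b∣ {+ suc m} {+ suc n} (+<+ ())
a*b<0⇒2≤∣a-b∣ { -[1+ m ]} { -[1+ n ]} (+<+ ())

a<a+b : ∀ a {b} → 0ℤ < b → a < a + b
a<a+b a b>0 = subst (_< a + _) (ℤP.+-identityʳ a) (ℤP.+-monoʳ-< a b>0)

[1+p+[1+d]]-[1+p]≡1+d : ∀ p d → + suc (p ℕ.+ suc d) - + suc p ≡ + suc d
[1+p+[1+d]]-[1+p]≡1+d p d = trans (cong (_- + suc p) (ℤP.pos-+ (suc p) (suc d))) (ring (+ suc p) (+ suc d))
  where
  ring : ∀ a b → (a + b) - a ≡ b
  ring = solve-∀

[1+q]-[1+q+[1+d]]≡-[1+d] : ∀ q d → + suc q - + suc (q ℕ.+ suc d) ≡ -[1+ d ]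
[1+q]-[1+q+[1+d]]≡-[1+d] q d = trans (cong (λ k → + suc q - k) (ℤP.pos-+ (suc q) (suc d))) (ring (+ suc q) (+ suc d))
  where
  ring : ∀ a b → a - (a + b) ≡ - b
  ring = solve-∀

m<n⇒n≡m+[1+k] : ∀ {m n} → m ℕ.< n → ∃[ k ] n ≡ m ℕ.+ suc k
m<n⇒n≡m+[1+k] {zero} {suc n} _ = n , refl
m<n⇒n≡m+[1+k] {suc m} {suc n} (s≤s m<n) with m<n⇒n≡m+[1+k] m<n
... | k , n≡ = k , cong suc n≡

n≤1+m⇒n≤1+[m⊓n] : ∀ m n → n ℕ.≤ suc m → n ℕ.≤ suc (m ⊓ n)
n≤1+m⇒n≤1+[m⊓n] m n n≤1+m with ℕP.⊓-sel m n
... | inj₁ m⊓n≡m = subst (λ k → n ℕ.≤ suc k) (sym m⊓n≡m) n≤1+m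
... | inj₂ m⊓n≡n = subst (λ k → n ℕ.≤ suc k) (sym m⊓n≡n) (ℕP.n≤1+n n)

m≤1+n⇒m≤1+[m⊓n] : ∀ m n → m ℕ.≤ suc n → m ℕ.≤ suc (m ⊓ n)
m≤1+n⇒m≤1+[m⊓n] m n m≤1+n = subst (λ k → m ℕ.≤ suc k) (ℕP.⊓-comm n m) (n≤1+m⇒n≤1+[m⊓n] n m m≤1+n)

neg-involutive : ∀ v → neg (neg v) ≡ v
neg-involutive (a , b) = cong₂ _,_ (ℤP.neg-involutive a) (ℤP.neg-involutive b)

~-sym : ∀ {v w} → v ~ w → w ~ v
~-sym (inj₁ refl) = inj₁ refl
~-sym (inj₂ refl) = inj₂ (sym (neg-involutive _))

~-trans : ∀ {v w z} → v ~ w → w ~ z → v ~ z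
~-trans (inj₁ refl) w~z = w~z
~-trans (inj₂ refl) (inj₁ refl) = inj₂ refl
~-trans (inj₂ refl) (inj₂ refl) = inj₁ (neg-involutive _)

1·v≡v : ∀ v → 1ℤ · v ≡ v
1·v≡v (a , b) = cong₂ _,_ (ℤP.*-identityˡ a) (ℤP.*-identityˡ b)

-1·v≡neg[v] : ∀ v → -1ℤ · v ≡ neg v
-1·v≡neg[v] (a , b) = cong₂ _,_ (ℤP.-1*i≡-i a) (ℤP.-1*i≡-i b)

⊕-comm : ∀ e f → e ⊕ f ≡ f ⊕ e
⊕-comm (e₁ , e₂) (f₁ , f₂) = cong₂ _,_ (ring e₁ f₁) (ring e₂ f₂)
  where
  ring : ∀ a b → a + b ≡ b + a
  ring = solve-∀

·-distribˡ-⊕ : ∀ a e f → a · (e ⊕ f) ≡ a · e ⊕ a · f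
·-distribˡ-⊕ a (e₁ , e₂) (f₁ , f₂) = cong₂ _,_ (ring a e₁ f₁) (ring a e₂ f₂)
  where
  ring : ∀ a e f → a * (e + f) ≡ a * e + a * f
  ring = solve-∀

1·e⊕1·f≡e⊕f : ∀ e f → 1ℤ · e ⊕ 1ℤ · f ≡ e ⊕ f
1·e⊕1·f≡e⊕f e f = cong₂ _⊕_ (1·v≡v e) (1·v≡v f)

a·e⊕[a+c]·f≡a·[e⊕f]⊕c·f : ∀ a c e f → a · e ⊕ (a + c) · f ≡ a · (e ⊕ f) ⊕ c · f
a·e⊕[a+c]·f≡a·[e⊕f]⊕c·f a c (e₁ , e₂) (f₁ , f₂) = cong₂ _,_ (ring a c e₁ f₁) (ring a c e₂ f₂)
  where
  ring : ∀ a c e f → a * e + (a + c) * f ≡ a * (e + f) + c * f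
  ring = solve-∀

[c+b]·e⊕b·f≡c·e⊕b·[e⊕f] : ∀ b c e f → (c + b) · e ⊕ b · f ≡ c · e ⊕ b · (e ⊕ f)
[c+b]·e⊕b·f≡c·e⊕b·[e⊕f] b c (e₁ , e₂) (f₁ , f₂) = cong₂ _,_ (ring b c e₁ f₁) (ring b c e₂ f₂)
  where
  ring : ∀ b c e f → (c + b) * e + b * f ≡ c * e + b * (e + f)
  ring = solve-∀

det-anti : ∀ v w → det w v ≡ - det v w
det-anti (a , b) (c , d) = ring a b c d
  where
  ring : ∀ a b c d → c * b - d * a ≡ - (a * d - b * c)
  ring = solve-∀

det-neg : ∀ v w → det v (neg w) ≡ - det v w
det-neg (a , b) (c , d) = ring a b c d
  where
  ring : ∀ a b c d → a * (- d) - b * (- c) ≡ - (a * d - b * c)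
  ring = solve-∀

det-self : ∀ v → det v v ≡ 0ℤ
det-self (a , b) = ring a b
  where
  ring : ∀ a b → a * b - b * a ≡ 0ℤ
  ring = solve-∀

~⇒det≡0 : ∀ {v w} → w ~ v → det v w ≡ 0ℤ
~⇒det≡0 {v = v} (inj₁ refl) = det-self v
~⇒det≡0 {v = v} (inj₂ refl) = trans (det-neg v v) (cong -_ (det-self v))

det[e,e⊕f] : ∀ e f → det e (e ⊕ f) ≡ det e f
det[e,e⊕f] (e₁ , e₂) (f₁ , f₂) = ring e₁ e₂ f₁ f₂
  where
  ring : ∀ e₁ e₂ f₁ f₂ → e₁ * (e₂ + f₂) - e₂ * (e₁ + f₁) ≡ e₁ * f₂ - e₂ * f₁
  ring = solve-∀

det[f,e⊕f] : ∀ e f → det f (e ⊕ f) ≡ - det e f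
det[f,e⊕f] (e₁ , e₂) (f₁ , f₂) = ring e₁ e₂ f₁ f₂
  where
  ring : ∀ e₁ e₂ f₁ f₂ → f₁ * (e₂ + f₂) - f₂ * (e₁ + f₁) ≡ - (e₁ * f₂ - e₂ * f₁)
  ring = solve-∀

det[e⊕f,f] : ∀ e f → det (e ⊕ f) f ≡ det e f
det[e⊕f,f] (e₁ , e₂) (f₁ , f₂) = ring e₁ e₂ f₁ f₂
  where
  ring : ∀ e₁ e₂ f₁ f₂ → (e₁ + f₁) * f₂ - (e₂ + f₂) * f₁ ≡ e₁ * f₂ - e₂ * f₁
  ring = solve-∀

det-⊕ʳ : ∀ x e f → det x (e ⊕ f) ≡ det x e + det x f
det-⊕ʳ (x₁ , x₂) (e₁ , e₂) (f₁ , f₂) = ring x₁ x₂ e₁ e₂ f₁ f₂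
  where
  ring : ∀ x₁ x₂ e₁ e₂ f₁ f₂ → x₁ * (e₂ + f₂) - x₂ * (e₁ + f₁) ≡ (x₁ * e₂ - x₂ * e₁) + (x₁ * f₂ - x₂ * f₁)
  ring = solve-∀

det-⊕ˡ : ∀ x e f → det (e ⊕ f) x ≡ det e x + det f x
det-⊕ˡ (x₁ , x₂) (e₁ , e₂) (f₁ , f₂) = ring x₁ x₂ e₁ e₂ f₁ f₂
  where
  ring : ∀ x₁ x₂ e₁ e₂ f₁ f₂ → (e₁ + f₁) * x₂ - (e₂ + f₂) * x₁ ≡ (e₁ * x₂ - e₂ * x₁) + (f₁ * x₂ - f₂ * x₁)
  ring = solve-∀

det[e,ae⊕bf] : ∀ a b e f → det e (a · e ⊕ b · f) ≡ b * det e f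
det[e,ae⊕bf] a b (e₁ , e₂) (f₁ , f₂) = ring a b e₁ e₂ f₁ f₂
  where
  ring : ∀ a b e₁ e₂ f₁ f₂ → e₁ * (a * e₂ + b * f₂) - e₂ * (a * e₁ + b * f₁) ≡ b * (e₁ * f₂ - e₂ * f₁)
  ring = solve-∀

det[f,ae⊕bf] : ∀ a b e f → det f (a · e ⊕ b · f) ≡ - (a * det e f)
det[f,ae⊕bf] a b (e₁ , e₂) (f₁ , f₂) = ring a b e₁ e₂ f₁ f₂
  where
  ring : ∀ a b e₁ e₂ f₁ f₂ → f₁ * (a * e₂ + b * f₂) - f₂ * (a * e₁ + b * f₁) ≡ - (a * (e₁ * f₂ - e₂ * f₁))
  ring = solve-∀

det[e⊕f,ae⊕bf] : ∀ a b e f → det (e ⊕ f) (a · e ⊕ b · f) ≡ (b - a) * det e f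
det[e⊕f,ae⊕bf] a b (e₁ , e₂) (f₁ , f₂) = ring a b e₁ e₂ f₁ f₂
  where
  ring : ∀ a b e₁ e₂ f₁ f₂ →
         (e₁ + f₁) * (a * e₂ + b * f₂) - (e₂ + f₂) * (a * e₁ + b * f₁) ≡ (b - a) * (e₁ * f₂ - e₂ * f₁)
  ring = solve-∀

det[x,u⊖x] : ∀ u x → det x (u ⊖ x) ≡ det x u
det[x,u⊖x] (u₁ , u₂) (x₁ , x₂) = ring u₁ u₂ x₁ x₂
  where
  ring : ∀ u₁ u₂ x₁ x₂ → x₁ * (u₂ - x₂) - x₂ * (u₁ - x₁) ≡ x₁ * u₂ - x₂ * u₁
  ring = solve-∀

det[u,u⊖x] : ∀ u x → det u (u ⊖ x) ≡ det x u
det[u,u⊖x] (u₁ , u₂) (x₁ , x₂) = ring u₁ u₂ x₁ x₂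
  where
  ring : ∀ u₁ u₂ x₁ x₂ → u₁ * (u₂ - x₂) - u₂ * (u₁ - x₁) ≡ x₁ * u₂ - x₂ * u₁
  ring = solve-∀

det[x,au⊕b[u⊖x]] : ∀ a b u x → det x (a · u ⊕ b · (u ⊖ x)) ≡ (a + b) * det x u
det[x,au⊕b[u⊖x]] a b (u₁ , u₂) (x₁ , x₂) = ring a b u₁ u₂ x₁ x₂
  where
  ring : ∀ a b u₁ u₂ x₁ x₂ →
         x₁ * (a * u₂ + b * (u₂ - x₂)) - x₂ * (a * u₁ + b * (u₁ - x₁)) ≡ (a + b) * (x₁ * u₂ - x₂ * u₁)
  ring = solve-∀

det[k·s,y] : ∀ k s y → det (k · s) y ≡ k * det s y
det[k·s,y] k (s₁ , s₂) (y₁ , y₂) = ring k s₁ s₂ y₁ y₂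
  where
  ring : ∀ k s₁ s₂ y₁ y₂ → k * s₁ * y₂ - k * s₂ * y₁ ≡ k * (s₁ * y₂ - s₂ * y₁)
  ring = solve-∀

det[ax⊕by,y] : ∀ a b x y → det (a · x ⊕ b · y) y ≡ a * det x y
det[ax⊕by,y] a b (x₁ , x₂) (y₁ , y₂) = ring a b x₁ x₂ y₁ y₂
  where
  ring : ∀ a b x₁ x₂ y₁ y₂ → (a * x₁ + b * y₁) * y₂ - (a * x₂ + b * y₂) * y₁ ≡ a * (x₁ * y₂ - x₂ * y₁)
  ring = solve-∀

cramer : ∀ e f w → det e f · w ≡ det w f · e ⊕ det e w · f
cramer (e₁ , e₂) (f₁ , f₂) (w₁ , w₂) = cong₂ _,_ (first e₁ e₂ f₁ f₂ w₁ w₂) (second e₁ e₂ f₁ f₂ w₁ w₂)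
  where
  first : ∀ e₁ e₂ f₁ f₂ w₁ w₂ →
          (e₁ * f₂ - e₂ * f₁) * w₁ ≡ (w₁ * f₂ - w₂ * f₁) * e₁ + (e₁ * w₂ - e₂ * w₁) * f₁
  first = solve-∀
  second : ∀ e₁ e₂ f₁ f₂ w₁ w₂ →
           (e₁ * f₂ - e₂ * f₁) * w₂ ≡ (w₁ * f₂ - w₂ * f₁) * e₂ + (e₁ * w₂ - e₂ * w₁) * f₂
  second = solve-∀

cramer² : ∀ x y s → (det x y * det x y) · s ≡ (det s y * det x y) · x ⊕ (det x s * det x y) · y
cramer² (x₁ , x₂) (y₁ , y₂) (s₁ , s₂) = cong₂ _,_ (first x₁ x₂ y₁ y₂ s₁ s₂) (second x₁ x₂ y₁ y₂ s₁ s₂)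
  where
  first : ∀ x₁ x₂ y₁ y₂ s₁ s₂ → (x₁ * y₂ - x₂ * y₁) * (x₁ * y₂ - x₂ * y₁) * s₁
          ≡ (s₁ * y₂ - s₂ * y₁) * (x₁ * y₂ - x₂ * y₁) * x₁ + (x₁ * s₂ - x₂ * s₁) * (x₁ * y₂ - x₂ * y₁) * y₁
  first = solve-∀
  second : ∀ x₁ x₂ y₁ y₂ s₁ s₂ → (x₁ * y₂ - x₂ * y₁) * (x₁ * y₂ - x₂ * y₁) * s₂
           ≡ (s₁ * y₂ - s₂ * y₁) * (x₁ * y₂ - x₂ * y₁) * x₂ + (x₁ * s₂ - x₂ * s₁) * (x₁ * y₂ - x₂ * y₁) * y₂
  second = solve-∀

plücker : ∀ e f z w → det e f * det z w ≡ det e z * det f w - det e w * det f z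
plücker (e₁ , e₂) (f₁ , f₂) (z₁ , z₂) (w₁ , w₂) = ring e₁ e₂ f₁ f₂ z₁ z₂ w₁ w₂
  where
  ring : ∀ e₁ e₂ f₁ f₂ z₁ z₂ w₁ w₂ →
         (e₁ * f₂ - e₂ * f₁) * (z₁ * w₂ - z₂ * w₁)
         ≡ (e₁ * z₂ - e₂ * z₁) * (f₁ * w₂ - f₂ * w₁) - (e₁ * w₂ - e₂ * w₁) * (f₁ * z₂ - f₂ * z₁)
  ring = solve-∀

Adj-sym : ∀ {v w} → Adj v w → Adj w v
Adj-sym {v} {w} v∼w = trans (cong ∣_∣ (det-anti v w)) (trans (ℤP.∣-i∣≡∣i∣ (det v w)) v∼w)

Adj⇒≁ : ∀ {v w} → Adj v w → ¬ (w ~ v)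
Adj⇒≁ {v} v∼w w~v with trans (sym v∼w) (cong ∣_∣ (~⇒det≡0 w~v))
... | ()

Adj⇒Primitive : ∀ {v w} → Adj v w → Primitive v
Adj⇒Primitive {v₁ , v₂} {w₁ , w₂} v∼w =
  ℕ.∣1⇒≡1 (subst (gcd ∣ v₁ ∣ ∣ v₂ ∣ ℕ.∣_) v∼w (∣⇒∣ᵤ (∣m∣n⇒∣m-n (∣m⇒∣m*n w₂ g∣v₁) (∣m⇒∣m*n w₁ g∣v₂))))
  where
  g∣v₁ : + gcd ∣ v₁ ∣ ∣ v₂ ∣ ℤ.∣ v₁
  g∣v₁ = ∣ᵤ⇒∣ (gcd[m,n]∣m ∣ v₁ ∣ ∣ v₂ ∣)
  g∣v₂ : + gcd ∣ v₁ ∣ ∣ v₂ ∣ ℤ.∣ v₂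
  g∣v₂ = ∣ᵤ⇒∣ (gcd[m,n]∣n ∣ v₁ ∣ ∣ v₂ ∣)

Primitive[k·v]⇒∣k∣≡1 : ∀ k v → Primitive (k · v) → ∣ k ∣ ≡ 1
Primitive[k·v]⇒∣k∣≡1 k (v₁ , v₂) prim = ℕ.∣1⇒≡1 (subst (∣ k ∣ ℕ.∣_) prim (gcd-greatest (∣k∣∣ v₁) (∣k∣∣ v₂)))
  where
  ∣k∣∣ : ∀ a → ∣ k ∣ ℕ.∣ ∣ k * a ∣
  ∣k∣∣ a = subst (∣ k ∣ ℕ.∣_) (sym (ℤP.abs-* k a)) (ℕ.m∣m*n ∣ a ∣)

Primitive[k·v]⇒k·v~v : ∀ k v → Primitive (k · v) → (k · v) ~ v
Primitive[k·v]⇒k·v~v k v prim with ∣a∣≡1⇒a≡±1 {k} (Primitive[k·v]⇒∣k∣≡1 k v prim)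
... | inj₁ refl = inj₁ (1·v≡v v)
... | inj₂ refl = inj₂ (-1·v≡neg[v] v)

private
  +∣a∣≡s*a : ∀ a → ∃[ s ] (+ ∣ a ∣ ≡ s * a)
  +∣a∣≡s*a (+ n) = 1ℤ , sym (ℤP.*-identityˡ (+ n))
  +∣a∣≡s*a -[1+ n ] = -1ℤ , sym (ℤP.-1*i≡-i -[1+ n ])

  [1+bn]≡am⇒am-bn≡1 : ∀ a m b n → 1 ℕ.+ b ℕ.* n ≡ a ℕ.* m → + a * + m - + b * + n ≡ 1ℤ
  [1+bn]≡am⇒am-bn≡1 a m b n eq = begin
    + a * + m - + b * + n              ≡⟨ cong₂ _-_ (ℤP.pos-* a m) (ℤP.pos-* b n) ⟨
    + (a ℕ.* m) - + (b ℕ.* n)          ≡⟨ cong (λ c → + c - + (b ℕ.* n)) eq ⟨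
    + (1 ℕ.+ b ℕ.* n) - + (b ℕ.* n)    ≡⟨ cong (_- + (b ℕ.* n)) (ℤP.pos-+ 1 (b ℕ.* n)) ⟩
    1ℤ + + (b ℕ.* n) - + (b ℕ.* n)     ≡⟨ ring (+ (b ℕ.* n)) ⟩
    1ℤ                                 ∎
    where
    open ≡-Reasoning
    ring : ∀ c → 1ℤ + c - c ≡ 1ℤ
    ring = solve-∀

unimodular-partner : ∀ {v} → Primitive v → ∃[ w ] det v w ≡ 1ℤ
unimodular-partner {v₁ , v₂} prim
  with +∣a∣≡s*a v₁ | +∣a∣≡s*a v₂
     | Bézout.identity (subst (GCD ∣ v₁ ∣ ∣ v₂ ∣) prim (gcd-GCD ∣ v₁ ∣ ∣ v₂ ∣))
... | s₁ , ∣v₁∣≡ | s₂ , ∣v₂∣≡ | Bézout.+- a b 1+b∣v₂∣≡a∣v₁∣ = (+ b * s₂ , + a * s₁) , (begin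
    v₁ * (+ a * s₁) - v₂ * (+ b * s₂)      ≡⟨ ring v₁ v₂ (+ a) (+ b) s₁ s₂ ⟩
    + a * (s₁ * v₁) - + b * (s₂ * v₂)      ≡⟨ cong₂ (λ p q → + a * p - + b * q) ∣v₁∣≡ ∣v₂∣≡ ⟨
    + a * + ∣ v₁ ∣ - + b * + ∣ v₂ ∣        ≡⟨ [1+bn]≡am⇒am-bn≡1 a (∣ v₁ ∣) b (∣ v₂ ∣) 1+b∣v₂∣≡a∣v₁∣ ⟩
    1ℤ                                     ∎)
  where
  open ≡-Reasoning
  ring : ∀ v₁ v₂ a b s₁ s₂ → v₁ * (a * s₁) - v₂ * (b * s₂) ≡ a * (s₁ * v₁) - b * (s₂ * v₂)
  ring = solve-∀
... | s₁ , ∣v₁∣≡ | s₂ , ∣v₂∣≡ | Bézout.-+ a b 1+a∣v₁∣≡b∣v₂∣ = (- (+ b * s₂) , - (+ a * s₁)) , (begin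
    v₁ * - (+ a * s₁) - v₂ * - (+ b * s₂)  ≡⟨ ring v₁ v₂ (+ a) (+ b) s₁ s₂ ⟩
    + b * (s₂ * v₂) - + a * (s₁ * v₁)      ≡⟨ cong₂ (λ p q → + b * p - + a * q) ∣v₂∣≡ ∣v₁∣≡ ⟨
    + b * + ∣ v₂ ∣ - + a * + ∣ v₁ ∣        ≡⟨ [1+bn]≡am⇒am-bn≡1 b (∣ v₂ ∣) a (∣ v₁ ∣) 1+a∣v₁∣≡b∣v₂∣ ⟩
    1ℤ                                     ∎)
  where
  open ≡-Reasoning
  ring : ∀ v₁ v₂ a b s₁ s₂ → v₁ * - (a * s₁) - v₂ * - (b * s₂) ≡ b * (s₂ * v₂) - a * (s₁ * v₁)
  ring = solve-∀

decompose : ∀ {v w z} → det v w ≡ 1ℤ → z ≡ (- det w z) · v ⊕ det v z · w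
decompose {v} {w} {z} det≡1 = begin
  z                               ≡⟨ 1·v≡v z ⟨
  1ℤ · z                          ≡⟨ cong (_· z) det≡1 ⟨
  det v w · z                     ≡⟨ cramer v w z ⟩
  det z w · v ⊕ det v z · w       ≡⟨ cong (λ c → c · v ⊕ det v z · w) (det-anti w z) ⟩
  (- det w z) · v ⊕ det v z · w   ∎
  where open ≡-Reasoning

collinear⇒~ : ∀ {v z} → Primitive v → Primitive z → det v z ≡ 0ℤ → z ~ v
collinear⇒~ {v} {z} prim-v prim-z det≡0 with unimodular-partner {v} prim-v
... | w , det[v,w]≡1 = subst (_~ v) (sym z≡) (Primitive[k·v]⇒k·v~v (- det w z) v (subst Primitive z≡ prim-z))
  where
  drop-zero : ∀ k v w → k · v ⊕ 0ℤ · w ≡ k · v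
  drop-zero k (v₁ , v₂) (w₁ , w₂) = cong₂ _,_ (ring k v₁ w₁) (ring k v₂ w₂)
    where
    ring : ∀ k v w → k * v + 0ℤ * w ≡ k * v
    ring = solve-∀
  z≡ : z ≡ (- det w z) · v
  z≡ = trans (decompose {v} {w} {z} det[v,w]≡1) (trans (cong (λ c → (- det w z) · v ⊕ c · w) det≡0) (drop-zero (- det w z) v w))

private
  det[x,σv-Qx] : ∀ σ Q x v → det x (σ · v ⊖ Q · x) ≡ σ * det x v
  det[x,σv-Qx] σ Q (x₁ , x₂) (v₁ , v₂) = ring σ Q x₁ x₂ v₁ v₂
    where
    ring : ∀ σ Q x₁ x₂ v₁ v₂ → x₁ * (σ * v₂ - Q * x₂) - x₂ * (σ * v₁ - Q * x₁) ≡ σ * (x₁ * v₂ - x₂ * v₁)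
    ring = solve-∀

  exact-multiple : ∀ σ Q n x v → (- (0ℤ + Q * n)) · x ⊕ (σ * n) · v ≡ n · (σ · v ⊖ Q · x)
  exact-multiple σ Q n (x₁ , x₂) (v₁ , v₂) = cong₂ _,_ (ring σ Q n x₁ v₁) (ring σ Q n x₂ v₂)
    where
    ring : ∀ σ Q n x v → (- (0ℤ + Q * n)) * x + (σ * n) * v ≡ n * (σ * v - Q * x)
    ring = solve-∀

  remainder-split : ∀ σ Q a b x v →
    (- (a + Q * (a + b))) · x ⊕ (σ * (a + b)) · v ≡ b · (σ · v ⊖ Q · x) ⊕ a · ((σ · v ⊖ Q · x) ⊖ x)
  remainder-split σ Q a b (x₁ , x₂) (v₁ , v₂) = cong₂ _,_ (ring σ Q a b x₁ v₁) (ring σ Q a b x₂ v₂)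
    where
    ring : ∀ σ Q a b x v →
           (- (a + Q * (a + b))) * x + (σ * (a + b)) * v ≡ b * (σ * v - Q * x) + a * ((σ * v - Q * x) - x)
    ring = solve-∀

-- With det x v = 1 and det x y = σ N (σ = ±1), dividing det v y = m + Q N by N gives
-- u = σ v - Q x with y = N u - m x; the remainder m cannot be 0, since then y = N u forces N = 1,
-- that is, x adjacent to y.
start-vector : ∀ x y → Primitive x → Primitive y → ¬ (x ~ y) → ¬ Adj x y →
  ∃[ u ] ∃[ i ] ∃[ j ] (Adj x u × y ≡ (+ suc j) · u ⊕ (+ suc i) · (u ⊖ x))
start-vector x y prim-x prim-y x≁y ¬x∼y with unimodular-partner {x} prim-x
... | v , det[x,v]≡1 = by-sign (det x y) refl
  where
  r = det v y
  y≡ : y ≡ (- r) · x ⊕ det x y · v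
  y≡ = decompose {x} {v} {y} det[x,v]≡1

  from-quotient : ∀ σ N → ∣ σ ∣ ≡ 1 → det x y ≡ σ * + suc N →
    ∃[ u ] ∃[ i ] ∃[ j ] (Adj x u × y ≡ (+ suc j) · u ⊕ (+ suc i) · (u ⊖ x))
  from-quotient σ N ∣σ∣≡1 D≡
    with r %ℕ suc N | a≡a%ℕn+[a/ℕn]*n r (suc N) | n%ℕd<d r (suc N)
  ... | zero | r≡ | _ = ⊥-elim (¬x∼y (begin
      ∣ det x y ∣        ≡⟨ cong ∣_∣ D≡ ⟩
      ∣ σ * + suc N ∣    ≡⟨ ℤP.abs-* σ (+ suc N) ⟩
      ∣ σ ∣ ℕ.* suc N    ≡⟨ cong₂ ℕ._*_ ∣σ∣≡1 1+N≡1 ⟩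
      1                  ∎))
    where
    open ≡-Reasoning
    u = σ · v ⊖ (r /ℕ suc N) · x
    y≡Nu : y ≡ (+ suc N) · u
    y≡Nu = trans y≡ (trans (cong₂ (λ a b → (- a) · x ⊕ b · v) r≡ D≡) (exact-multiple σ (r /ℕ suc N) (+ suc N) x v))
    1+N≡1 : suc N ≡ 1
    1+N≡1 = Primitive[k·v]⇒∣k∣≡1 (+ suc N) u (subst Primitive y≡Nu prim-y)
  ... | suc i | r≡ | i<N with m<n⇒n≡m+[1+k] i<N
  ...   | j , N≡ = u , i , j , x∼u , (begin
      y                                                        ≡⟨ y≡ ⟩
      (- r) · x ⊕ det x y · v                                  ≡⟨ cong₂ (λ a b → (- a) · x ⊕ b · v) r≡ D≡ ⟩
      (- (+ suc i + Q * + suc N)) · x ⊕ (σ * + suc N) · v      ≡⟨ cong (λ n → (- (+ suc i + Q * n)) · x ⊕ (σ * n) · v) N≡′ ⟩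
      (- (+ suc i + Q * (+ suc i + + suc j))) · x ⊕ (σ * (+ suc i + + suc j)) · v
                                                               ≡⟨ remainder-split σ Q (+ suc i) (+ suc j) x v ⟩
      (+ suc j) · u ⊕ (+ suc i) · (u ⊖ x)                      ∎)
    where
    open ≡-Reasoning
    Q = r /ℕ suc N
    u = σ · v ⊖ Q · x
    N≡′ : + suc N ≡ + suc i + + suc j
    N≡′ = trans (cong +_ N≡) (ℤP.pos-+ (suc i) (suc j))
    x∼u : Adj x u
    x∼u = trans (cong ∣_∣ (trans (det[x,σv-Qx] σ Q x v) (trans (cong (σ *_) det[x,v]≡1) (ℤP.*-identityʳ σ)))) ∣σ∣≡1

  by-sign : ∀ D → det x y ≡ D →
    ∃[ u ] ∃[ i ] ∃[ j ] (Adj x u × y ≡ (+ suc j) · u ⊕ (+ suc i) · (u ⊖ x))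
  by-sign (+ suc n) D≡ = from-quotient 1ℤ n refl (trans D≡ (sym (ℤP.*-identityˡ (+ suc n))))
  by-sign -[1+ n ] D≡ = from-quotient -1ℤ n refl (trans D≡ (sym (ℤP.-1*i≡-i (+ suc n))))
  by-sign (+ 0) D≡ = ⊥-elim (x≁y (~-sym {y} {x} (collinear⇒~ {x} {y} prim-x prim-y D≡)))

side : V → V → V → ℤ
side e f z = det e z * det f z

side-resp-~ : ∀ {z w} e f → z ~ w → side e f z ≡ side e f w
side-resp-~ e f (inj₁ refl) = refl
side-resp-~ {w = w} e f (inj₂ refl) =
  trans (cong₂ _*_ (det-neg e w) (det-neg f w)) (ring (det e w) (det f w))
  where
  ring : ∀ a b → (- a) * (- b) ≡ a * b
  ring = solve-∀

-- By Plücker, det e f * det z w = ez * fw - ew * fz, a difference of two integers of opposite signs.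
Adj⇒¬side-flip : ∀ {e f z w} → Adj e f → Adj z w → 0ℤ < side e f z → ¬ (side e f w < 0ℤ)
Adj⇒¬side-flip {e} {f} {z} {w} e∼f z∼w 0<side[z] side[w]<0 =
  2≰1 (subst (2 ℕ.≤_) ∣ez*fw-ew*fz∣≡1 (a*b<0⇒2≤∣a-b∣ {ez * fw} {ew * fz} opposite))
  where
  ez = det e z
  fz = det f z
  ew = det e w
  fw = det f w
  opposite : (ez * fw) * (ew * fz) < 0ℤ
  opposite = subst (_< 0ℤ) (ring ez fz ew fw) (*-pos-neg {ez * fz} {ew * fw} 0<side[z] side[w]<0)
    where
    ring : ∀ a b c d → (a * b) * (c * d) ≡ (a * d) * (c * b)
    ring = solve-∀
  open ≡-Reasoning
  ∣ez*fw-ew*fz∣≡1 : ∣ ez * fw - ew * fz ∣ ≡ 1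
  ∣ez*fw-ew*fz∣≡1 = begin
    ∣ ez * fw - ew * fz ∣        ≡⟨ cong ∣_∣ (plücker e f z w) ⟨
    ∣ det e f * det z w ∣        ≡⟨ ℤP.abs-* (det e f) (det z w) ⟩
    ∣ det e f ∣ ℕ.* ∣ det z w ∣  ≡⟨ cong₂ ℕ._*_ e∼f z∼w ⟩
    1                            ∎
  2≰1 : ¬ (2 ℕ.≤ 1)
  2≰1 (s≤s ())

record Crossing (e f s z : V) (rest : List V) : Set where
  field
    before after : List V
    rest≡ : rest ≡ before ++ after
    walk : Linked Adj (z ∷ before)
    hits : LastIs e (z ∷ before) ⊎ LastIs f (z ∷ before)
    after-nonempty : 1 ℕ.≤ length after
    after-ends : LastIs s after

crossing : ∀ {e f s} → Adj e f → side e f s < 0ℤ →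
           ∀ z rest → 0ℤ < side e f z → Linked Adj (z ∷ rest) → LastIs s (z ∷ rest) → Crossing e f s z rest
crossing {e} {f} e∼f side[s]<0 z [] 0<side[z] _ z~s =
  ⊥-elim (ℤP.<-asym (subst (0ℤ <_) (side-resp-~ e f z~s) 0<side[z]) side[s]<0)
crossing {e} {f} {s} e∼f side[s]<0 z (w ∷ rest) 0<side[z] (z∼w ∷ w-walk) ends
  with ℤP.<-cmp 0ℤ (side e f w)
... | tri< 0<side[w] _ _ = record
  { before = w ∷ before ; after = after ; rest≡ = cong (w ∷_) rest≡ ; walk = z∼w ∷ walk′
  ; hits = hits ; after-nonempty = after-nonempty ; after-ends = after-ends }
  where open Crossing (crossing {e} {f} {s} e∼f side[s]<0 w rest 0<side[w] w-walk ends) renaming (walk to walk′)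
... | tri> _ _ side[w]<0 = ⊥-elim (Adj⇒¬side-flip {e} {f} e∼f z∼w 0<side[z] side[w]<0)
... | tri≈ _ 0≡side[w] _ with rest
...   | [] = ⊥-elim (ℤP.<-irrefl (sym (trans 0≡side[w] (side-resp-~ e f ends))) side[s]<0)
...   | r ∷ rs = record
  { before = w ∷ [] ; after = r ∷ rs ; rest≡ = refl ; walk = z∼w ∷ [-]
  ; hits = on-line (ℤP.i*j≡0⇒i≡0∨j≡0 (det e w) (sym 0≡side[w]))
  ; after-nonempty = s≤s z≤n ; after-ends = ends }
  where
  w-primitive : Primitive w
  w-primitive = Adj⇒Primitive {w} {z} (Adj-sym {z} {w} z∼w)
  on-line : det e w ≡ 0ℤ ⊎ det f w ≡ 0ℤ → LastIs e (z ∷ w ∷ []) ⊎ LastIs f (z ∷ w ∷ [])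
  on-line (inj₁ det≡0) = inj₁ (collinear⇒~ (Adj⇒Primitive {e} {f} e∼f) w-primitive det≡0)
  on-line (inj₂ det≡0) = inj₂ (collinear⇒~ (Adj⇒Primitive {f} {e} (Adj-sym {e} {f} e∼f)) w-primitive det≡0)

LengthBound : (V → Set) → ℕ → List V → Set
LengthBound K n p = n ℕ.≤ length p × (length p ℕ.≤ n → All K p)

LowerBound : (V → Set) → V → V → ℕ → Set
LowerBound K x v n = ∀ p → Linked Adj p → HeadIs x p → LastIs v p → LengthBound K n p

private
  short-split : ∀ {A B m} → A ℕ.+ B ℕ.≤ suc m → 1 ℕ.≤ B → m ℕ.≤ A → A ℕ.≤ m × B ℕ.≤ 1
  short-split {A} {B} {m} A+B≤1+m 1≤B m≤A =
    ℕP.+-cancelʳ-≤ 1 A m (begin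
      A ℕ.+ 1   ≤⟨ ℕP.+-monoʳ-≤ A 1≤B ⟩
      A ℕ.+ B   ≤⟨ A+B≤1+m ⟩
      suc m     ≡⟨ ℕP.+-comm 1 m ⟩
      m ℕ.+ 1   ∎) ,
    ℕP.+-cancelˡ-≤ m B 1 (begin
      m ℕ.+ B   ≤⟨ ℕP.+-monoˡ-≤ B m≤A ⟩
      A ℕ.+ B   ≤⟨ A+B≤1+m ⟩
      suc m     ≡⟨ ℕP.+-comm 1 m ⟩
      m ℕ.+ 1   ∎)
    where open ℕP.≤-Reasoning

module _ {K : V → Set} (K-resp-~ : ∀ {a b} → a ~ b → K b → K a) {x : V} where

  lowerBound-adjacent : ∀ {v} → Adj x v → K x → K v → LowerBound K x v 2
  lowerBound-adjacent x∼v Kx Kv [] _ () _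
  lowerBound-adjacent {v} x∼v Kx Kv (a ∷ []) _ a~x a~v = ⊥-elim (Adj⇒≁ {x} {v} x∼v (~-trans (~-sym a~v) a~x))
  lowerBound-adjacent {v} x∼v Kx Kv (a ∷ b ∷ r) _ a~x ends = s≤s (s≤s z≤n) , all-K r ends
    where
    all-K : ∀ r → LastIs v (a ∷ b ∷ r) → length (a ∷ b ∷ r) ℕ.≤ 2 → All K (a ∷ b ∷ r)
    all-K [] b~v _ = K-resp-~ a~x Kx ∷ K-resp-~ b~v Kv ∷ []
    all-K (_ ∷ _) _ (s≤s (s≤s ()))

  lowerBound-through : ∀ {s h k m} z before after → m ℕ.≤ k → LowerBound K x h k →
    Linked Adj (z ∷ before) → HeadIs x (z ∷ before) → LastIs h (z ∷ before) →
    1 ℕ.≤ length after → LastIs s after → K s → LengthBound K (suc m) (z ∷ before ++ after)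
  lowerBound-through {s} {m = m} z before after m≤k bound walk starts ends-h 1≤B ends-s Ks =
    subst (suc m ℕ.≤_) (sym length≡)
      (subst (ℕ._≤ A ℕ.+ B) (ℕP.+-comm m 1) (ℕP.+-mono-≤ m≤A 1≤B)) ,
    λ short → let (A≤m , B≤1) = short-split (subst (ℕ._≤ suc m) length≡ short) 1≤B m≤A
              in ++⁺ (proj₂ hit (ℕP.≤-trans A≤m m≤k)) (single-K after 1≤B B≤1 ends-s)
    where
    A = length (z ∷ before)
    B = length after
    length≡ : length (z ∷ before ++ after) ≡ A ℕ.+ B
    length≡ = cong suc (length-++ before)
    hit = bound (z ∷ before) walk starts ends-h
    m≤A : m ℕ.≤ A
    m≤A = ℕP.≤-trans m≤k (proj₁ hit)
    single-K : ∀ after → 1 ℕ.≤ length after → length after ℕ.≤ 1 → LastIs s after → All K after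
    single-K (w ∷ []) _ _ w~s = K-resp-~ w~s Ks ∷ []
    single-K (w ∷ _ ∷ _) _ (s≤s ()) _

  lowerBound-sum : ∀ {e f s m n} → Adj e f → 0ℤ < side e f x → side e f s < 0ℤ → K s →
                   LowerBound K x e m → LowerBound K x f n → LowerBound K x s (suc (m ⊓ n))
  lowerBound-sum e∼f x-side s-side Ks bound-e bound-f [] _ () _
  lowerBound-sum {e} {f} {s} {m} {n} e∼f x-side s-side Ks bound-e bound-f (z ∷ rest) z-walk z~x ends =
    subst (λ r → LengthBound K (suc (m ⊓ n)) (z ∷ r)) (sym rest≡) (via hits)
    where
    open Crossing (crossing {e} {f} {s} e∼f s-side z rest
                     (subst (0ℤ <_) (sym (side-resp-~ e f z~x)) x-side) z-walk ends)
    via : LastIs e (z ∷ before) ⊎ LastIs f (z ∷ before) → LengthBound K (suc (m ⊓ n)) (z ∷ before ++ after)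
    via (inj₁ ends-e) =
      lowerBound-through z before after (ℕP.m⊓n≤m m n) bound-e walk z~x ends-e after-nonempty after-ends Ks
    via (inj₂ ends-f) =
      lowerBound-through z before after (ℕP.m⊓n≤n m n) bound-f walk z~x ends-f after-nonempty after-ends Ks

Ends : V → List V → Set
Ends v [] = ⊥
Ends v (a ∷ []) = a ≡ v
Ends v (_ ∷ b ∷ l) = Ends v (b ∷ l)

Ends⇒LastIs : ∀ {v} l → Ends v l → LastIs v l
Ends⇒LastIs (a ∷ []) refl = inj₁ refl
Ends⇒LastIs (a ∷ b ∷ l) ends = Ends⇒LastIs (b ∷ l) ends

module _ {R : V → V → Set} where

  Linked-∷ʳ : ∀ a l {u v} → Linked R (a ∷ l) → Ends u (a ∷ l) → R u v → Linked R (a ∷ l ∷ʳ v)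
  Linked-∷ʳ a [] _ refl r = r ∷ [-]
  Linked-∷ʳ a (b ∷ l) (r′ ∷ linked) ends r = r′ ∷ Linked-∷ʳ b l linked ends r

Ends-∷ʳ : ∀ a l v → Ends v (a ∷ l ∷ʳ v)
Ends-∷ʳ a [] v = refl
Ends-∷ʳ a (b ∷ l) v = Ends-∷ʳ b l v

length-∷ʳ : ∀ (a : V) l v → length (a ∷ l ∷ʳ v) ≡ suc (length (a ∷ l))
length-∷ʳ a [] v = refl
length-∷ʳ a (b ∷ l) v = cong suc (length-∷ʳ b l v)

KleinV-resp-~ : ∀ {x y a b} → a ~ b → KleinV x y b → KleinV x y a
KleinV-resp-~ a~b (inj₁ b~x) = inj₁ (~-trans a~b b~x)
KleinV-resp-~ a~b (inj₂ (inj₁ b~y)) = inj₂ (inj₁ (~-trans a~b b~y))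
KleinV-resp-~ a~b (inj₂ (inj₂ (¬x∼y , q , e₁ , f₁ , setup , k , t , e , f , reach , inj₁ b~e))) =
  inj₂ (inj₂ (¬x∼y , q , e₁ , f₁ , setup , k , t , e , f , reach , inj₁ (~-trans a~b b~e)))
KleinV-resp-~ a~b (inj₂ (inj₂ (¬x∼y , q , e₁ , f₁ , setup , k , t , e , f , reach , inj₂ b~f))) =
  inj₂ (inj₂ (¬x∼y , q , e₁ , f₁ , setup , k , t , e , f , reach , inj₂ (~-trans a~b b~f)))

Signed : Bool → ℤ → Set
Signed true a = 0ℤ < a
Signed false a = a < 0ℤ

Signed-*-pos : ∀ q {a c} → Signed q a → 0ℤ < c → Signed q (c * a)
Signed-*-pos true a>0 c>0 = *-pos c>0 a>0
Signed-*-pos false a<0 c>0 = *-pos-neg c>0 a<0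

Signed-*-neg : ∀ q {a c} → Signed q a → c < 0ℤ → ¬ Signed q (c * a)
Signed-*-neg true a>0 c<0 ca>0 = ℤP.<-asym ca>0 (*-neg-pos c<0 a>0)
Signed-*-neg false a<0 c<0 ca<0 = ℤP.<-asym (*-neg c<0 a<0) ca<0

module Transition (x y : V) (prim-x : Primitive x) (prim-y : Primitive y) (¬x∼y : ¬ Adj x y)
  (u : V) (i j : ℕ) (x∼u : Adj x u) (y-start : y ≡ (+ suc j) · u ⊕ (+ suc i) · (u ⊖ x)) where

  D : ℤ
  D = det x y

  -- Cramer's rule: D² s = xcoeff s · x + ycoeff s · y.
  xcoeff ycoeff : V → ℤ
  xcoeff s = det s y * D
  ycoeff s = det x s * D

  0<det[x,u]*D : 0ℤ < det x u * D
  0<det[x,u]*D = subst (0ℤ <_) (sym δD≡c) (+-pos {+ suc j} {+ suc i} (+<+ (s≤s z≤n)) (+<+ (s≤s z≤n)))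
    where
    δ = det x u
    c = + suc j + + suc i
    open ≡-Reasoning
    δD≡c : δ * D ≡ c
    δD≡c = begin
      δ * D              ≡⟨ cong (λ v → δ * det x v) y-start ⟩
      δ * (det x (+ suc j · u ⊕ + suc i · (u ⊖ x)))
                         ≡⟨ cong (δ *_) (det[x,au⊕b[u⊖x]] (+ suc j) (+ suc i) u x) ⟩
      δ * (c * δ)        ≡⟨ ring c δ ⟩
      c * (δ * δ)        ≡⟨ cong (c *_) (∣a∣≡1⇒a*a≡1 {δ} x∼u) ⟩
      c * 1ℤ             ≡⟨ ℤP.*-identityʳ c ⟩
      c                  ∎
      where
      ring : ∀ c δ → δ * (c * δ) ≡ c * (δ * δ)
      ring = solve-∀

  0<D*D : 0ℤ < D * D
  0<D*D = a≢0⇒0<a*a (λ D≡0 → 0≮a*0 (det x u) (subst (λ d → 0ℤ < det x u * d) D≡0 0<det[x,u]*D))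

  ycoeff-⊕ : ∀ e f → ycoeff (e ⊕ f) ≡ ycoeff e + ycoeff f
  ycoeff-⊕ e f = trans (cong (_* D) (det-⊕ʳ x e f)) (ℤP.*-distribʳ-+ D (det x e) (det x f))

  InQ-intro : ∀ q s → 0ℤ < ycoeff s → Signed q (xcoeff s) → InQ q x y s
  InQ-intro q s 0<ycoeff signed with 0<⇒≡+[1+] 0<D*D | 0<⇒≡+[1+] 0<ycoeff
  ... | m , D*D≡ | b , ycoeff≡ = intro q signed
    where
    D²s≡ : ∀ a → xcoeff s ≡ a → (+ suc m) · s ≡ a · x ⊕ (+ suc b) · y
    D²s≡ a xcoeff≡ =
      trans (cong (_· s) (sym D*D≡)) (trans (cramer² x y s) (cong₂ (λ α β → α · x ⊕ β · y) xcoeff≡ ycoeff≡))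
    intro : ∀ q → Signed q (xcoeff s) → InQ q x y s
    intro true 0<xcoeff with 0<⇒≡+[1+] 0<xcoeff
    ... | a , xcoeff≡ = m , a , b , D²s≡ _ xcoeff≡
    intro false xcoeff<0 with <0⇒≡-[1+] xcoeff<0
    ... | a , xcoeff≡ = m , a , b , D²s≡ _ xcoeff≡

  k*xcoeff : ∀ k a b s → k · s ≡ a · x ⊕ b · y → k * xcoeff s ≡ a * (D * D)
  k*xcoeff k a b s s≡ = begin
    k * (det s y * D)              ≡⟨ ℤP.*-assoc k (det s y) D ⟨
    k * det s y * D                ≡⟨ cong (_* D) (det[k·s,y] k s y) ⟨
    det (k · s) y * D              ≡⟨ cong (λ v → det v y * D) s≡ ⟩
    det (a · x ⊕ b · y) y * D      ≡⟨ cong (_* D) (det[ax⊕by,y] a b x y) ⟩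
    a * D * D                      ≡⟨ ℤP.*-assoc a D D ⟩
    a * (D * D)                    ∎
    where open ≡-Reasoning

  InQ⇒Signed : ∀ q s → InQ q x y s → Signed q (xcoeff s)
  InQ⇒Signed true s (m , a , b , s≡) =
    0<[1+m]*a⇒0<a {xcoeff s} {m}
      (subst (0ℤ <_) (sym (k*xcoeff (+ suc m) (+ suc a) (+ suc b) s s≡)) (*-pos {+ suc a} (+<+ (s≤s z≤n)) 0<D*D))
  InQ⇒Signed false s (m , a , b , s≡) =
    [1+m]*a<0⇒a<0 {xcoeff s} {m}
      (subst (_< 0ℤ) (sym (k*xcoeff (+ suc m) -[1+ a ] (+ suc b) s s≡)) (*-neg-pos { -[1+ a ]} -<+ 0<D*D))

  module _ {q e₁ f₁ k t e f} (setup : Setup x y q e₁ f₁) (reach : Reach x y q e₁ f₁ k t e f) where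

    klein-e : KleinV x y e
    klein-e = inj₂ (inj₂ (¬x∼y , q , e₁ , f₁ , setup , k , t , e , f , reach , inj₁ (inj₁ refl)))

    klein-f : KleinV x y f
    klein-f = inj₂ (inj₂ (¬x∼y , q , e₁ , f₁ , setup , k , t , e , f , reach , inj₂ (inj₁ refl)))

    corner-e : ECorner t q x y e f → CornerV x y e
    corner-e c = inj₂ (inj₂ (¬x∼y , q , e₁ , f₁ , setup , k , t , e , f , reach , inj₁ (c , inj₁ refl)))

    corner-f : FCorner t q x y e f → CornerV x y f
    corner-f c = inj₂ (inj₂ (¬x∼y , q , e₁ , f₁ , setup , k , t , e , f , reach , inj₂ (c , inj₁ refl)))

  -- ycoeff strictly increases along the path, which makes its vertices pairwise distinct.
  record CornerPath (v : V) (n : ℕ) : Set where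
    constructor cornerPath
    field
      tail : List V
      walk : Linked Adj (x ∷ tail)
      ends : Ends v (x ∷ tail)
      length≡ : length (x ∷ tail) ≡ n
      corners : All (CornerV x y) (x ∷ tail)
      rising : Linked (λ a b → ycoeff a < ycoeff b) (x ∷ tail)
      nonneg : All (λ a → 0ℤ ≤ ycoeff a) (x ∷ tail)
      primitives : All Primitive (x ∷ tail)

  CornerPath-∷ʳ : ∀ {v w n} → CornerPath v n → Adj v w → ycoeff v < ycoeff w → 0ℤ ≤ ycoeff w →
                  Primitive w → CornerV x y w → CornerPath w (suc n)
  CornerPath-∷ʳ {w = w} (cornerPath tail walk ends length≡ corners rising nonneg primitives)
                v∼w v<w 0≤w prim-w corner-w =
    cornerPath (tail ∷ʳ w) (Linked-∷ʳ x tail walk ends v∼w) (Ends-∷ʳ x tail w)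
      (trans (length-∷ʳ x tail w) (cong suc length≡)) (∷ʳ⁺ corners corner-w)
      (Linked-∷ʳ x tail rising ends v<w) (∷ʳ⁺ nonneg 0≤w) (∷ʳ⁺ primitives prim-w)

  AlmostCornerPath : V → ℕ → Set
  AlmostCornerPath v n =
    Σ V λ w → Σ ℕ λ m → n ≡ suc m × CornerPath w m × Adj w v × ycoeff w < ycoeff v

  AlmostCornerPath⇒CornerPath : ∀ {v n} → AlmostCornerPath v n → 0ℤ ≤ ycoeff v → Primitive v →
                                CornerV x y v → CornerPath v n
  AlmostCornerPath⇒CornerPath (w , m , refl , path , w∼v , w<v) = CornerPath-∷ʳ path w∼v w<v

  -- After an E-step the new e is a corner only if the next step is not an E-step, so only a
  -- corner path to one of its neighbours is known (symmetrically for F).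
  CornerPaths : Kind → V → V → ℕ → ℕ → Set
  CornerPaths start e f m n = CornerPath e m × CornerPath f n
  CornerPaths stepE e f m n = CornerPath f n × AlmostCornerPath e m × n ℕ.≤ m
  CornerPaths stepF e f m n = CornerPath e m × AlmostCornerPath f n × m ℕ.≤ n

  Adj[e,e⊕f] : ∀ e f → Adj e f → Adj e (e ⊕ f)
  Adj[e,e⊕f] e f e∼f = trans (cong ∣_∣ (det[e,e⊕f] e f)) e∼f

  Adj[f,e⊕f] : ∀ e f → Adj e f → Adj f (e ⊕ f)
  Adj[f,e⊕f] e f e∼f = trans (cong ∣_∣ (det[f,e⊕f] e f)) (trans (ℤP.∣-i∣≡∣i∣ (det e f)) e∼f)

  side[e⊕f]<0 : ∀ e f → Adj e f → side e f (e ⊕ f) < 0ℤ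
  side[e⊕f]<0 e f e∼f =
    subst (_< 0ℤ) (sym (cong₂ _*_ (det[e,e⊕f] e f) (det[f,e⊕f] e f))) (∣a∣≡1⇒a*-a<0 {det e f} e∼f)

  via-e : ∀ {e f m n} → Adj e f → 0ℤ < ycoeff f → CornerPath e m → m ℕ.≤ n →
          AlmostCornerPath (e ⊕ f) (suc (m ⊓ n))
  via-e {e} {f} {m} {n} e∼f 0<f path m≤n =
    e , m ⊓ n , refl , subst (CornerPath e) (sym (ℕP.m≤n⇒m⊓n≡m m≤n)) path , Adj[e,e⊕f] e f e∼f ,
    subst (ycoeff e <_) (sym (ycoeff-⊕ e f)) (a<a+b (ycoeff e) 0<f)

  via-f : ∀ {e f m n} → Adj e f → 0ℤ < ycoeff e → CornerPath f n → n ℕ.≤ m →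
          AlmostCornerPath (e ⊕ f) (suc (m ⊓ n))
  via-f {e} {f} {m} {n} e∼f 0<e path n≤m =
    f , m ⊓ n , refl , subst (CornerPath f) (sym (ℕP.m≥n⇒m⊓n≡n n≤m)) path , Adj[f,e⊕f] e f e∼f ,
    subst (ycoeff f <_) (trans (ℤP.+-comm (ycoeff f) (ycoeff e)) (sym (ycoeff-⊕ e f))) (a<a+b (ycoeff f) 0<e)

  via-shorter : ∀ {e f m n} → Adj e f → 0ℤ < ycoeff e → 0ℤ < ycoeff f → CornerPath e m → CornerPath f n →
                AlmostCornerPath (e ⊕ f) (suc (m ⊓ n))
  via-shorter {m = m} {n} e∼f 0<e 0<f path-e path-f with ℕP.≤-total m n
  ... | inj₁ m≤n = via-e e∼f 0<f path-e m≤n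
  ... | inj₂ n≤m = via-f e∼f 0<e path-f n≤m

  xcoeff[e⊕f] : ∀ e f p q → y ≡ (+ suc p) · e ⊕ (+ suc q) · f →
                xcoeff (e ⊕ f) ≡ (+ suc q - + suc p) * (det e f * D)
  xcoeff[e⊕f] e f p q y≡ =
    trans (cong (λ v → det (e ⊕ f) v * D) y≡)
      (trans (cong (_* D) (det[e⊕f,ae⊕bf] (+ suc p) (+ suc q) e f)) (ℤP.*-assoc (+ suc q - + suc p) (det e f) D))

  e⊕f≢y-via-e : ∀ e f p m → y ≡ (+ suc p) · e ⊕ (+ suc (suc m)) · f → Adj e f → ¬ (e ⊕ f ≡ y)
  e⊕f≢y-via-e e f p m y≡ e∼f e⊕f≡y = ∣a∣≡1⇒a≢[2+m]*a {det e f} {m} e∼f (begin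
    det e f                                           ≡⟨ det[e,e⊕f] e f ⟨
    det e (e ⊕ f)                                     ≡⟨ cong (det e) (trans e⊕f≡y y≡) ⟩
    det e ((+ suc p) · e ⊕ (+ suc (suc m)) · f)       ≡⟨ det[e,ae⊕bf] (+ suc p) (+ suc (suc m)) e f ⟩
    + suc (suc m) * det e f                           ∎)
    where open ≡-Reasoning

  e⊕f≢y-via-f : ∀ e f m q → y ≡ (+ suc (suc m)) · e ⊕ (+ suc q) · f → Adj e f → ¬ (e ⊕ f ≡ y)
  e⊕f≢y-via-f e f m q y≡ e∼f e⊕f≡y =
    ∣a∣≡1⇒a≢[2+m]*a { - det e f} {m} (trans (ℤP.∣-i∣≡∣i∣ (det e f)) e∼f) (begin
    - det e f                                         ≡⟨ det[f,e⊕f] e f ⟨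
    det f (e ⊕ f)                                     ≡⟨ cong (det f) (trans e⊕f≡y y≡) ⟩
    det f ((+ suc (suc m)) · e ⊕ (+ suc q) · f)       ≡⟨ det[f,ae⊕bf] (+ suc (suc m)) (+ suc q) e f ⟩
    - (+ suc (suc m) * det e f)                       ≡⟨ ℤP.neg-distribʳ-* (+ suc (suc m)) (det e f) ⟩
    + suc (suc m) * - det e f                         ∎)
    where open ≡-Reasoning

  y≢k·e⊕k·f : ∀ e f m → ¬ (y ≡ (+ suc (suc m)) · e ⊕ (+ suc (suc m)) · f)
  y≢k·e⊕k·f e f m y≡ with Primitive[k·v]⇒∣k∣≡1 (+ suc (suc m)) (e ⊕ f)
                           (subst Primitive (trans y≡ (sym (·-distribˡ-⊕ (+ suc (suc m)) e f))) prim-y)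
  ... | ()

  sum∈Qₑ : ∀ cone e f p d → y ≡ (+ suc p) · e ⊕ (+ suc (p ℕ.+ suc d)) · f → Signed cone (det e f * D) →
           0ℤ < ycoeff e → 0ℤ < ycoeff f → InQ cone x y (e ⊕ f)
  sum∈Qₑ cone e f p d y≡ orientation 0<ycoeff[e] 0<ycoeff[f] =
    InQ-intro cone (e ⊕ f) (subst (0ℤ <_) (sym (ycoeff-⊕ e f)) (+-pos 0<ycoeff[e] 0<ycoeff[f]))
      (subst (Signed cone) (sym xcoeff≡) (Signed-*-pos cone {c = + suc d} orientation (+<+ (s≤s z≤n))))
    where
    xcoeff≡ : xcoeff (e ⊕ f) ≡ + suc d * (det e f * D)
    xcoeff≡ = trans (xcoeff[e⊕f] e f p (p ℕ.+ suc d) y≡)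
                    (cong (_* (det e f * D)) ([1+p+[1+d]]-[1+p]≡1+d p d))

  record State : Set where
    field
      cone : Bool
      e₁ f₁ : V
      setup : Setup x y cone e₁ f₁
      steps : ℕ
      kind : Kind
      e f : V
      reach : Reach x y cone e₁ f₁ steps kind e f
      p q : ℕ
      y≡ : y ≡ (+ suc p) · e ⊕ (+ suc q) · f
      e∼f : Adj e f
      orientation : Signed cone (det e f * D)
      0<ycoeff[e] : 0ℤ < ycoeff e
      0<ycoeff[f] : 0ℤ < ycoeff f
      0<side[x] : 0ℤ < side e f x
      dist-e dist-f : ℕ
      dist-e≤1+dist-f : dist-e ℕ.≤ suc dist-f
      dist-f≤1+dist-e : dist-f ℕ.≤ suc dist-e
      bound-e : LowerBound (KleinV x y) x e dist-e
      bound-f : LowerBound (KleinV x y) x f dist-f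
      paths : CornerPaths kind e f dist-e dist-f

  e-step : (st : State) → ∀ d → State.q st ≡ State.p st ℕ.+ suc d →
           Σ State λ st′ → State.p st′ ≡ State.p st × State.q st′ ≡ d
  e-step st d q≡ = record
    { cone = cone ; e₁ = e₁ ; f₁ = f₁ ; setup = setup ; steps = suc steps ; kind = stepE ; e = s ; f = f
    ; reach = reach′ ; p = p ; q = d ; y≡ = y≡′ ; e∼f = trans (cong ∣_∣ (det[e⊕f,f] e f)) e∼f
    ; orientation = subst (λ a → Signed cone (a * D)) (sym (det[e⊕f,f] e f)) orientation
    ; 0<ycoeff[e] = 0<ycoeff[s] ; 0<ycoeff[f] = 0<ycoeff[f]
    ; 0<side[x] = subst (λ a → 0ℤ < a * det f x) (sym (det-⊕ˡ x e f)) (0<*⇒0<[a+b]*b {det e x} {det f x} 0<side[x])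
    ; dist-e = suc (dist-e ⊓ dist-f) ; dist-f = dist-f
    ; dist-e≤1+dist-f = s≤s (ℕP.m⊓n≤n dist-e dist-f)
    ; dist-f≤1+dist-e = ℕP.≤-trans (n≤1+m⇒n≤1+[m⊓n] dist-e dist-f dist-f≤1+dist-e) (ℕP.n≤1+n _)
    ; bound-e = lowerBound-sum (KleinV-resp-~ {x} {y}) e∼f 0<side[x] (side[e⊕f]<0 e f e∼f) (klein-e setup reach′)
                  bound-e bound-f
    ; bound-f = bound-f ; paths = paths′ kind reach paths } , refl , refl
    where
    open State st
    s = e ⊕ f
    0<ycoeff[s] : 0ℤ < ycoeff s
    0<ycoeff[s] = subst (0ℤ <_) (sym (ycoeff-⊕ e f)) (+-pos 0<ycoeff[e] 0<ycoeff[f])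
    s∈Qₑ : InQ cone x y s
    s∈Qₑ = sum∈Qₑ cone e f p d (subst (λ n → y ≡ (+ suc p) · e ⊕ (+ suc n) · f) q≡ y≡)
             orientation 0<ycoeff[e] 0<ycoeff[f]
    s≢y : ¬ (s ≡ y)
    s≢y = e⊕f≢y-via-e e f p (p ℕ.+ d)
            (subst (λ n → y ≡ (+ suc p) · e ⊕ (+ suc n) · f) (trans q≡ (ℕP.+-suc p d)) y≡) e∼f
    reach′ : Reach x y cone e₁ f₁ (suc steps) stepE s f
    reach′ = eStep reach s≢y s∈Qₑ
    y≡′ : y ≡ (+ suc p) · s ⊕ (+ suc d) · f
    y≡′ = trans y≡ (trans (cong (λ n → (+ suc p) · e ⊕ (+ suc n) · f) q≡)
            (trans (cong (λ a → (+ suc p) · e ⊕ a · f) (ℤP.pos-+ (suc p) (suc d)))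
              (a·e⊕[a+c]·f≡a·[e⊕f]⊕c·f (+ suc p) (+ suc d) e f)))
    paths′ : ∀ t → Reach x y cone e₁ f₁ steps t e f → CornerPaths t e f dist-e dist-f →
             CornerPaths stepE s f (suc (dist-e ⊓ dist-f)) dist-f
    paths′ start _ (path-e , path-f) =
      path-f , via-shorter e∼f 0<ycoeff[e] 0<ycoeff[f] path-e path-f , n≤1+m⇒n≤1+[m⊓n] dist-e dist-f dist-f≤1+dist-e
    paths′ stepE _ (path-f , _ , f≤e) =
      path-f , via-f e∼f 0<ycoeff[e] path-f f≤e , n≤1+m⇒n≤1+[m⊓n] dist-e dist-f dist-f≤1+dist-e
    paths′ stepF r (path-e , almost-f , e≤f) =
      AlmostCornerPath⇒CornerPath almost-f (ℤP.<⇒≤ 0<ycoeff[f]) (Adj⇒Primitive {f} {e} (Adj-sym {e} {f} e∼f))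
        (corner-f setup r (inj₂ s∈Qₑ)) ,
      via-e e∼f 0<ycoeff[f] path-e e≤f , n≤1+m⇒n≤1+[m⊓n] dist-e dist-f dist-f≤1+dist-e

  f-step : (st : State) → ∀ d → State.p st ≡ State.q st ℕ.+ suc d →
           Σ State λ st′ → State.p st′ ≡ d × State.q st′ ≡ State.q st
  f-step st d p≡ = record
    { cone = cone ; e₁ = e₁ ; f₁ = f₁ ; setup = setup ; steps = suc steps ; kind = stepF ; e = e ; f = s
    ; reach = reach′ ; p = d ; q = q ; y≡ = y≡′ ; e∼f = trans (cong ∣_∣ (det[e,e⊕f] e f)) e∼f
    ; orientation = subst (λ a → Signed cone (a * D)) (sym (det[e,e⊕f] e f)) orientation
    ; 0<ycoeff[e] = 0<ycoeff[e] ; 0<ycoeff[f] = 0<ycoeff[s]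
    ; 0<side[x] = subst (λ a → 0ℤ < det e x * a) (sym (det-⊕ˡ x e f)) (0<*⇒0<a*[a+b] {det e x} {det f x} 0<side[x])
    ; dist-e = dist-e ; dist-f = suc (dist-e ⊓ dist-f)
    ; dist-e≤1+dist-f = ℕP.≤-trans (m≤1+n⇒m≤1+[m⊓n] dist-e dist-f dist-e≤1+dist-f) (ℕP.n≤1+n _)
    ; dist-f≤1+dist-e = s≤s (ℕP.m⊓n≤m dist-e dist-f)
    ; bound-e = bound-e
    ; bound-f = lowerBound-sum (KleinV-resp-~ {x} {y}) e∼f 0<side[x] (side[e⊕f]<0 e f e∼f) (klein-f setup reach′)
                  bound-e bound-f
    ; paths = paths′ kind reach paths } , refl , refl
    where
    open State st
    s = e ⊕ f
    0<ycoeff[s] : 0ℤ < ycoeff s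
    0<ycoeff[s] = subst (0ℤ <_) (sym (ycoeff-⊕ e f)) (+-pos 0<ycoeff[e] 0<ycoeff[f])
    xcoeff[s]≡ : xcoeff s ≡ -[1+ d ] * (det e f * D)
    xcoeff[s]≡ = begin
      xcoeff s                                          ≡⟨ xcoeff[e⊕f] e f p q y≡ ⟩
      (+ suc q - + suc p) * (det e f * D)               ≡⟨ cong (λ n → (+ suc q - + suc n) * (det e f * D)) p≡ ⟩
      (+ suc q - + suc (q ℕ.+ suc d)) * (det e f * D)   ≡⟨ cong (_* (det e f * D)) ([1+q]-[1+q+[1+d]]≡-[1+d] q d) ⟩
      -[1+ d ] * (det e f * D)                          ∎
      where open ≡-Reasoning
    s∉Qₑ : ¬ InQ cone x y s
    s∉Qₑ s∈Qₑ = Signed-*-neg cone {c = -[1+ d ]} orientation -<+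
                  (subst (Signed cone) xcoeff[s]≡ (InQ⇒Signed cone s s∈Qₑ))
    s≢y : ¬ (s ≡ y)
    s≢y = e⊕f≢y-via-f e f (q ℕ.+ d) q
            (subst (λ n → y ≡ (+ suc n) · e ⊕ (+ suc q) · f) (trans p≡ (ℕP.+-suc q d)) y≡) e∼f
    reach′ : Reach x y cone e₁ f₁ (suc steps) stepF e s
    reach′ = fStep reach s≢y s∉Qₑ
    y≡′ : y ≡ (+ suc d) · e ⊕ (+ suc q) · s
    y≡′ = trans y≡ (trans (cong (λ n → (+ suc n) · e ⊕ (+ suc q) · f) p≡)
            (trans (cong (λ a → a · e ⊕ (+ suc q) · f)
                     (trans (ℤP.pos-+ (suc q) (suc d)) (ℤP.+-comm (+ suc q) (+ suc d))))
              ([c+b]·e⊕b·f≡c·e⊕b·[e⊕f] (+ suc q) (+ suc d) e f)))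
    paths′ : ∀ t → Reach x y cone e₁ f₁ steps t e f → CornerPaths t e f dist-e dist-f →
             CornerPaths stepF e s dist-e (suc (dist-e ⊓ dist-f))
    paths′ start _ (path-e , path-f) =
      path-e , via-shorter e∼f 0<ycoeff[e] 0<ycoeff[f] path-e path-f , m≤1+n⇒m≤1+[m⊓n] dist-e dist-f dist-e≤1+dist-f
    paths′ stepF _ (path-e , _ , e≤f) =
      path-e , via-e e∼f 0<ycoeff[f] path-e e≤f , m≤1+n⇒m≤1+[m⊓n] dist-e dist-f dist-e≤1+dist-f
    paths′ stepE r (path-f , almost-e , f≤e) =
      AlmostCornerPath⇒CornerPath almost-e (ℤP.<⇒≤ 0<ycoeff[e]) (Adj⇒Primitive {e} {f} e∼f)
        (corner-e setup r (inj₂ s∉Qₑ)) ,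
      via-f e∼f 0<ycoeff[e] path-f f≤e , m≤1+n⇒m≤1+[m⊓n] dist-e dist-f dist-e≤1+dist-f

  Final : Set
  Final = Σ ℕ λ n → LowerBound (KleinV x y) x y n × CornerPath y n

  final-step : (st : State) → State.p st ≡ 0 → State.q st ≡ 0 → Final
  final-step st p≡0 q≡0 =
    suc (dist-e ⊓ dist-f) ,
    subst (λ v → LowerBound (KleinV x y) x v (suc (dist-e ⊓ dist-f))) s≡y
      (lowerBound-sum (KleinV-resp-~ {x} {y}) e∼f 0<side[x] (side[e⊕f]<0 e f e∼f) (inj₂ (inj₁ (inj₁ s≡y)))
         bound-e bound-f) ,
    subst (λ v → CornerPath v (suc (dist-e ⊓ dist-f))) s≡y
      (AlmostCornerPath⇒CornerPath
         (via-shorter e∼f 0<ycoeff[e] 0<ycoeff[f] (proj₁ (both kind reach paths)) (proj₂ (both kind reach paths)))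
         (ℤP.<⇒≤ (subst (0ℤ <_) (sym (ycoeff-⊕ e f)) (+-pos 0<ycoeff[e] 0<ycoeff[f])))
         (subst Primitive (sym s≡y) prim-y) (inj₂ (inj₁ (inj₁ s≡y))))
    where
    open State st
    s≡y : e ⊕ f ≡ y
    s≡y = sym (trans y≡ (trans (cong₂ (λ a b → (+ suc a) · e ⊕ (+ suc b) · f) p≡0 q≡0) (1·e⊕1·f≡e⊕f e f)))
    both : ∀ t → Reach x y cone e₁ f₁ steps t e f → CornerPaths t e f dist-e dist-f →
           CornerPath e dist-e × CornerPath f dist-f
    both start _ paths = paths
    both stepE r (path-f , almost-e , _) =
      AlmostCornerPath⇒CornerPath almost-e (ℤP.<⇒≤ 0<ycoeff[e]) (Adj⇒Primitive {e} {f} e∼f)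
        (corner-e setup r (inj₁ s≡y)) , path-f
    both stepF r (path-e , almost-f , _) =
      path-e , AlmostCornerPath⇒CornerPath almost-f (ℤP.<⇒≤ 0<ycoeff[f]) (Adj⇒Primitive {f} {e} (Adj-sym {e} {f} e∼f))
        (corner-f setup r (inj₁ s≡y))

  balanced : (st : State) → State.p st ≡ State.q st → Final
  balanced st p≡q with State.p st in p≡
  ... | zero = final-step st p≡ (sym p≡q)
  ... | suc c = ⊥-elim (y≢k·e⊕k·f e f c
                  (trans y≡ (cong₂ (λ a b → (+ suc a) · e ⊕ (+ suc b) · f) p≡ (sym p≡q))))
    where open State st

  measure : State → ℕ
  measure st = State.p st ℕ.+ State.q st

  advance : (st : State) → Final ⊎ Σ State (λ st′ → measure st′ ℕ.< measure st)
  advance st with ℕP.<-cmp (State.p st) (State.q st)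
  ... | tri≈ _ p≡q _ = inj₁ (balanced st p≡q)
  ... | tri< p<q _ _ =
    let (d , q≡) = m<n⇒n≡m+[1+k] p<q
        (st′ , p′≡ , q′≡) = e-step st d q≡
    in inj₂ (st′ , subst₂ (λ a b → a ℕ.+ b ℕ.< measure st) (sym p′≡) (sym q′≡)
                     (ℕP.+-monoʳ-< (State.p st) (subst (d ℕ.<_) (sym q≡) (ℕP.m≤n+m (suc d) (State.p st)))))
  ... | tri> _ _ q<p =
    let (d , p≡) = m<n⇒n≡m+[1+k] q<p
        (st′ , p′≡ , q′≡) = f-step st d p≡
    in inj₂ (st′ , subst₂ (λ a b → a ℕ.+ b ℕ.< measure st) (sym p′≡) (sym q′≡)
                     (ℕP.+-monoˡ-< (State.q st) (subst (d ℕ.<_) (sym p≡) (ℕP.m≤n+m (suc d) (State.q st)))))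

  run : ∀ n (st : State) → measure st ℕ.< n → Final
  run zero st ()
  run (suc n) st measure<1+n with advance st
  ... | inj₁ final = final
  ... | inj₂ (st′ , measure′<measure) = run n st′ (ℕP.<-≤-trans measure′<measure (ℕ.s≤s⁻¹ measure<1+n))

  w : V
  w = u ⊖ x

  x∼w : Adj x w
  x∼w = trans (cong ∣_∣ (det[x,u⊖x] u x)) x∼u

  u∼w : Adj u w
  u∼w = trans (cong ∣_∣ (det[u,u⊖x] u x)) x∼u

  0<ycoeff[u] : 0ℤ < ycoeff u
  0<ycoeff[u] = 0<det[x,u]*D

  0<ycoeff[w] : 0ℤ < ycoeff w
  0<ycoeff[w] = subst (λ a → 0ℤ < a * D) (sym (det[x,u⊖x] u x)) 0<det[x,u]*D

  0<det[u,w]*D : 0ℤ < det u w * D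
  0<det[u,w]*D = subst (λ a → 0ℤ < a * D) (sym (det[u,u⊖x] u x)) 0<det[x,u]*D

  det[w,u]*D<0 : det w u * D < 0ℤ
  det[w,u]*D<0 = subst (_< 0ℤ) (trans (ℤP.neg-distribˡ-* (det u w) D) (cong (_* D) (sym (det-anti u w))))
                   (ℤP.neg-mono-< 0<det[u,w]*D)

  0<side[u,w,x] : 0ℤ < side u w x
  0<side[u,w,x] = subst (0ℤ <_) (sym side≡) (subst (0ℤ <_) (sym (∣a∣≡1⇒a*a≡1 {det x u} x∼u)) (+<+ (s≤s z≤n)))
    where
    side≡ : side u w x ≡ det x u * det x u
    side≡ = trans (cong₂ _*_ (det-anti x u) (trans (det-anti x w) (cong -_ (det[x,u⊖x] u x)))) (ring (det x u))
      where
      ring : ∀ a → (- a) * (- a) ≡ a * a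
      ring = solve-∀

  y≡wu : y ≡ (+ suc i) · w ⊕ (+ suc j) · u
  y≡wu = trans y-start (⊕-comm ((+ suc j) · u) ((+ suc i) · w))

  u-is-start : IsU x y u
  u-is-start = x∼u , InQ-intro true u 0<ycoeff[u] 0<xcoeff[u] , InQ-intro false w 0<ycoeff[w] xcoeff[w]<0
    where
    0<xcoeff[u] : 0ℤ < xcoeff u
    0<xcoeff[u] = subst (0ℤ <_)
      (sym (trans (cong (λ v → det u v * D) y-start)
             (trans (cong (_* D) (det[e,ae⊕bf] (+ suc j) (+ suc i) u w)) (ℤP.*-assoc (+ suc i) (det u w) D))))
      (*-pos {+ suc i} (+<+ (s≤s z≤n)) 0<det[u,w]*D)
    xcoeff[w]<0 : xcoeff w < 0ℤ
    xcoeff[w]<0 = subst (_< 0ℤ)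
      (sym (trans (cong (λ v → det w v * D) y-start)
             (trans (cong (_* D) (det[f,ae⊕bf] (+ suc j) (+ suc i) u w)) (ring (+ suc j) (det u w) D))))
      (*-neg-pos { -[1+ j ]} -<+ 0<det[u,w]*D)
      where
      ring : ∀ a δ D → - (a * δ) * D ≡ (- a) * (δ * D)
      ring = solve-∀

  path₂ : ∀ v → Adj x v → 0ℤ < ycoeff v → CornerV x y v → CornerPath v 2
  path₂ v x∼v 0<v corner-v =
    cornerPath (v ∷ []) (x∼v ∷ [-]) refl refl (inj₁ (inj₁ refl) ∷ corner-v ∷ [])
      (subst (_< ycoeff v) ycoeff[x]≡0 0<v ∷ [-])
      (subst (0ℤ ≤_) ycoeff[x]≡0 (+≤+ z≤n) ∷ ℤP.<⇒≤ 0<v ∷ [])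
      (prim-x ∷ Adj⇒Primitive {v} {x} (Adj-sym {x} {v} x∼v) ∷ [])
    where
    ycoeff[x]≡0 : 0ℤ ≡ ycoeff x
    ycoeff[x]≡0 = sym (cong (_* D) (det-self x))

  initial : ∀ cone e f → Setup x y cone e f → ∀ p q → y ≡ (+ suc p) · e ⊕ (+ suc q) · f → Adj e f →
            Signed cone (det e f * D) → 0ℤ < ycoeff e → 0ℤ < ycoeff f → 0ℤ < side e f x →
            Adj x e → Adj x f → State
  initial cone e f setup p q y≡ e∼f orientation 0<e 0<f 0<side x∼e x∼f = record
    { cone = cone ; e₁ = e ; f₁ = f ; setup = setup ; steps = 0 ; kind = start ; e = e ; f = f ; reach = init
    ; p = p ; q = q ; y≡ = y≡ ; e∼f = e∼f ; orientation = orientation ; 0<ycoeff[e] = 0<e ; 0<ycoeff[f] = 0<f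
    ; 0<side[x] = 0<side ; dist-e = 2 ; dist-f = 2 ; dist-e≤1+dist-f = ℕP.n≤1+n 2 ; dist-f≤1+dist-e = ℕP.n≤1+n 2
    ; bound-e = lowerBound-adjacent (KleinV-resp-~ {x} {y}) x∼e (inj₁ (inj₁ refl)) (klein-e setup init)
    ; bound-f = lowerBound-adjacent (KleinV-resp-~ {x} {y}) x∼f (inj₁ (inj₁ refl)) (klein-f setup init)
    ; paths = path₂ e x∼e 0<e (corner-e setup init tt) , path₂ f x∼f 0<f (corner-f setup init tt) }

  initial-state : State
  initial-state with ℕP.<-cmp j i
  ... | tri< j<i _ _ with m<n⇒n≡m+[1+k] j<i
  ...   | d , i≡ = initial true u w (viaP u u-is-start u⊕w≢y u⊕w∈P) j i y-start u∼w 0<det[u,w]*D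
                     0<ycoeff[u] 0<ycoeff[w] 0<side[u,w,x] x∼u x∼w
    where
    y≡′ : y ≡ (+ suc j) · u ⊕ (+ suc (j ℕ.+ suc d)) · w
    y≡′ = subst (λ n → y ≡ (+ suc j) · u ⊕ (+ suc n) · w) i≡ y-start
    u⊕w≢y : ¬ (u ⊕ w ≡ y)
    u⊕w≢y = e⊕f≢y-via-e u w j (j ℕ.+ d)
              (subst (λ n → y ≡ (+ suc j) · u ⊕ (+ suc n) · w) (ℕP.+-suc j d) y≡′) u∼w
    u⊕w∈P : InP x y (u ⊕ w)
    u⊕w∈P = sum∈Qₑ true u w j d y≡′ 0<det[u,w]*D 0<ycoeff[u] 0<ycoeff[w]
  initial-state | tri> _ _ i<j with m<n⇒n≡m+[1+k] i<j
  ...   | d , j≡ = initial false w u (viaN u u-is-start u⊕w≢y u⊕w∈N) i j y≡wu (Adj-sym {u} {w} u∼w) det[w,u]*D<0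
                     0<ycoeff[w] 0<ycoeff[u] (subst (0ℤ <_) (ℤP.*-comm (det u x) (det w x)) 0<side[u,w,x]) x∼w x∼u
    where
    y≡′ : y ≡ (+ suc i) · w ⊕ (+ suc (i ℕ.+ suc d)) · u
    y≡′ = subst (λ n → y ≡ (+ suc i) · w ⊕ (+ suc n) · u) j≡ y≡wu
    u⊕w≢y : ¬ (u ⊕ w ≡ y)
    u⊕w≢y u⊕w≡y = e⊕f≢y-via-e w u i (i ℕ.+ d)
                    (subst (λ n → y ≡ (+ suc i) · w ⊕ (+ suc n) · u) (ℕP.+-suc i d) y≡′) (Adj-sym {u} {w} u∼w)
                    (trans (⊕-comm w u) u⊕w≡y)
    u⊕w∈N : InN x y (u ⊕ w)
    u⊕w∈N = subst (InN x y) (⊕-comm w u) (sum∈Qₑ false w u i d y≡′ det[w,u]*D<0 0<ycoeff[w] 0<ycoeff[u])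
  initial-state | tri≈ _ j≡i _ = balanced-start i (subst (λ n → y ≡ (+ suc n) · u ⊕ (+ suc i) · w) j≡i y-start)
    where
    balanced-start : ∀ k → y ≡ (+ suc k) · u ⊕ (+ suc k) · w → State
    balanced-start zero y≡ = initial true u w (stop u u-is-start (sym (trans y≡ (1·e⊕1·f≡e⊕f u w)))) 0 0 y≡ u∼w
                               0<det[u,w]*D 0<ycoeff[u] 0<ycoeff[w] 0<side[u,w,x] x∼u x∼w
    balanced-start (suc k) y≡ = ⊥-elim (y≢k·e⊕k·f u w k y≡)

  rising⇒distinct : ∀ l → All (λ a → 0ℤ ≤ ycoeff a) l → AllPairs (λ a b → ycoeff a < ycoeff b) l →
                    AllPairs (λ a b → ¬ (a ~ b)) l
  rising⇒distinct [] _ _ = []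
  rising⇒distinct (a ∷ l) (0≤a ∷ nonneg) (a<l ∷ rising) = All.map (≁ 0≤a) a<l ∷ rising⇒distinct l nonneg rising
    where
    ≁ : ∀ {a b} → 0ℤ ≤ ycoeff a → ycoeff a < ycoeff b → ¬ (a ~ b)
    ≁ _ a<b (inj₁ refl) = ℤP.<-irrefl refl a<b
    ≁ {b = b} 0≤a a<b (inj₂ refl) = ℤP.<-irrefl refl (ℤP.≤-<-trans 0≤-Y (ℤP.neg-mono-< (ℤP.≤-<-trans 0≤-Y -Y<Y)))
      where
      ycoeff[neg] : ycoeff (neg b) ≡ - ycoeff b
      ycoeff[neg] = trans (cong (_* D) (det-neg x b)) (sym (ℤP.neg-distribˡ-* (det x b) D))
      0≤-Y : 0ℤ ≤ - ycoeff b
      0≤-Y = subst (0ℤ ≤_) ycoeff[neg] 0≤a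
      -Y<Y : - ycoeff b < ycoeff b
      -Y<Y = subst (_< ycoeff b) ycoeff[neg] a<b

  geodesic : Σ (List V) λ P → PathBetween x y P × All (CornerV x y) P × LowerBound (KleinV x y) x y (length P)
  geodesic with run _ initial-state (ℕP.n<1+n _)
  ... | n , bound , cornerPath tail walk ends length≡ corners rising nonneg primitives =
    x ∷ tail ,
    ((primitives , walk , rising⇒distinct (x ∷ tail) nonneg (Linked⇒AllPairs ℤP.<-trans rising)) ,
     inj₁ refl , Ends⇒LastIs (x ∷ tail) ends) ,
    corners , subst (LowerBound (KleinV x y) x y) (sym length≡) bound

module _ {K C : V → Set} {x y : V} where

  shortest-paths : ∀ P → PathBetween x y P → All C P → LowerBound K x y (length P) →
                   ((p : List V) → Shortest x y p → All K p) × (∃[ p ] (Shortest x y p × All C p))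
  shortest-paths P path-P C-P bound =
    (λ p (((_ , walk , _) , starts , ends) , minimal) → proj₂ (bound p walk starts ends) (minimal P path-P)) ,
    P , (path-P , λ q ((_ , walk , _) , starts , ends) → proj₁ (bound q walk starts ends)) , C-P

lemma4 : (x y : V) → Primitive x → Primitive y → ¬ (x ~ y) →
    ((p : List V) → Shortest x y p → All (KleinV x y) p)
    × (∃[ p ] (Shortest x y p × All (CornerV x y) p))
lemma4 x y prim-x prim-y x≁y with ∣ det x y ∣ ℕ.≟ 1
... | yes x∼y = shortest-paths (x ∷ y ∷ [])
        (((prim-x ∷ prim-y ∷ []) , (x∼y ∷ [-]) , ((x≁y ∷ []) ∷ [] ∷ [])) , inj₁ refl , inj₁ refl)
        (inj₁ (inj₁ refl) ∷ inj₂ (inj₁ (inj₁ refl)) ∷ [])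
        (lowerBound-adjacent (KleinV-resp-~ {x} {y}) x∼y (inj₁ (inj₁ refl)) (inj₂ (inj₁ (inj₁ refl))))
... | no ¬x∼y with start-vector x y prim-x prim-y x≁y ¬x∼y
...   | u , i , j , x∼u , y≡ with Transition.geodesic x y prim-x prim-y ¬x∼y u i j x∼u y≡
...     | P , path-P , corners , bound = shortest-paths P path-P corners bound
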